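{- Let $T=(T,S,\epsilon F)$ be a BY forest. (1) If $T_0$ is the BY forest formed by taking the disjoint union of the closures of the components of $T\setminus S$ (with subgraph the preimage of $S$ and the induced signed automorphism), then $\bar\Phi_T\cong\bar\Phi_{T_0}$ as $\mathbb Z[\epsilon F]$-modules. (2) If $T$ is a disjoint union of $F$-stable BY subforests $T_i$, then $\bar\Phi_T\cong\bigoplus_i\bar\Phi_{T_i}$ as $\mathbb Z[\epsilon F]$-modules. (3) If $T$ consists of a single $F$-orbit of $q$ trees $T_0,FT_0,\dots,F^{q-1}T_0$, then $\bar\Phi_T\cong\mathrm{Ind}_{(\epsilon F)^q}^{\epsilon F}\bar\Phi_{T_0}$ as $\mathbb Z[\epsilon F]$-modules, where $T_0$ is regarded as the BY tree with subgraph $S\cap T_0$ and signed automorphism $(\epsilon F)^q|_{T_0}$. (4) If $S=\emptyset$ or $S=T$, then $\bar\Phi_T=0$. Moreover, in (1)--(3), if $T$ satisfies parity condition (A) (resp. (B)), then so do all the BY forests $T_0$, $T_i$ appearing there.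
   Context: A BY forest is a triple $T=(T,S,\epsilon F)$ where $T$ is a finite graph-theoretic forest with an edge-length function $l:E(T)\to\{1,2,3,\dots\}$ (distances are sums of edge lengths), $S\subseteq T$ is a subgraph, $F$ is a length-preserving graph automorphism of $T$ with $F(S)=S$, and $\epsilon:\pi_0(T\setminus S)\to\{\pm1\}$ is a function on the connected components of the topological complement $T\setminus S$. For $n\ge1$, $(\epsilon F)^n$ has underlying automorphism $F^n$ and sign $C\mapsto\prod_{i=0}^{n-1}\epsilon(F^iC)$. Let $\Lambda_T=H_1(T,S;\mathbb Z)$, viewed inside the free abelian group on oriented edges not in $S$, with intersection length pairing the restriction of $\langle e,e'\rangle=l(e)\delta_{e,e'}$; the signed automorphism acts by sending the class of a path $\gamma$ in the closure of a component $C$ of $T\setminus S$ to $\epsilon(C)[F\gamma]$. The geometric Néron component group is $\bar\Phi_T=\Lambda_T^\vee/\Lambda_T$ ($\Lambda_T^\vee=\mathrm{Hom}(\Lambda_T,\mathbb Z)$, $\Lambda_T\hookrightarrow\Lambda_T^\vee$ induced by the pairing), a $\mathbb Z[\epsilon F]$-module. For a module $M$ over $\mathbb Z[\sigma^q]$, $\mathrm{Ind}_{\sigma^q}^{\sigma}M=\mathbb Z[\sigma]\otimes_{\mathbb Z[\sigma^q]}M$. Parity condition (A): if two vertices of $T$ lie an odd distance apart, then at least one is either (i) a leaf in $S$ whose incident edge is not in $S$, (ii) of degree $2$ and not in $S$, or (iii) of degree $2$ and in the interior of $S$. Parity condition (B): no iterate of $F$ inverts (maps to itself with endpoints swapped)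 any edge of odd length. -}

module Defs where

open import Data.Nat using (ℕ; zero; suc; _≤_; _%_) renaming (_+_ to _+ℕ_)
open import Data.Integer using (ℤ; 0ℤ; 1ℤ; -1ℤ; +_; _+_; _*_)
open import Data.Fin using (Fin; zero; suc; inject₁; fromℕ)
open import Data.Fin.Properties using (_≟_)
open import Data.Bool using (Bool; true; false; if_then_else_)
open import Data.Sign using (Sign) renaming (_*_ to _*ˢ_)
open import Data.Sum using (_⊎_; inj₁; inj₂)
open import Data.Product using (Σ; _×_; _,_)
open import Data.List using (List; []; _∷_)
open import Data.List.Relation.Unary.Unique.Propositional using (Unique)
open import Relation.Nullary using (¬_; does)
open import Relation.Binary.PropositionalEquality using (_≡_)
open import Relation.Binary.Construct.Closure.ReflexiveTransitive using (Star)
open import Function.Definitions using (Injective)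

iter : {A : Set} → (A → A) → ℕ → A → A
iter f zero    x = x
iter f (suc n) x = f (iter f n x)

Σℤ : {n : ℕ} → (Fin n → ℤ) → ℤ
Σℤ {zero}  f = 0ℤ
Σℤ {suc n} f = f zero + Σℤ (λ i → f (suc i))

Σℕ : {n : ℕ} → (Fin n → ℕ) → ℕ
Σℕ {zero}  f = 0
Σℕ {suc n} f = f zero +ℕ Σℕ (λ i → f (suc i))

Πˢ : {n : ℕ} → (Fin n → Sign) → Sign
Πˢ {zero}  f = Sign.+
Πˢ {suc n} f = f zero *ˢ Πˢ (λ i → f (suc i))

sgnℤ : Sign → ℤ
sgnℤ Sign.+ = 1ℤ
sgnℤ Sign.- = -1ℤ

[_≟ᶠ_]ℤ : {n : ℕ} → Fin n → Fin n → ℤ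
[ a ≟ᶠ b ]ℤ = if does (a ≟ b) then 1ℤ else 0ℤ

[_≟ᶠ_]ℕ : {n : ℕ} → Fin n → Fin n → ℕ
[ a ≟ᶠ b ]ℕ = if does (a ≟ b) then 1 else 0

Odd : ℕ → Set
Odd n = n % 2 ≡ 1

-- Finite multigraphs: vertices Fin nV, edges Fin nE, each edge e has
-- endpoints src e, tgt e (this also fixes a reference orientation).

record Graph : Set where
  field
    nV nE : ℕ
    src tgt : Fin nE → Fin nV

module _ (G : Graph) where
  open Graph G

  Joins : Fin nE → Fin nV → Fin nV → Set
  Joins e a b = (src e ≡ a × tgt e ≡ b) ⊎ (src e ≡ b × tgt e ≡ a)

  Incident : Fin nE → Fin nV → Set
  Incident e v = src e ≡ v ⊎ tgt e ≡ v

  -- a cycle: distinct vertices v_0,…,v_k (k ≥ 0), v_{k+1} = v_0, and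
  -- distinct edges e_0,…,e_k with e_i joining v_i and v_{i+1}.
  -- (k = 0 is a loop, k = 1 a pair of parallel edges.)
  record Cycle : Set where
    field
      k   : ℕ
      vs  : Fin (suc (suc k)) → Fin nV
      es  : Fin (suc k) → Fin nE
      closed : vs zero ≡ vs (fromℕ (suc k))
      vs-inj : Injective _≡_ _≡_ (λ (i : Fin (suc k)) → vs (inject₁ i))
      es-inj : Injective _≡_ _≡_ es
      joins  : ∀ i → Joins (es i) (vs (inject₁ i)) (vs (suc i))

  IsForest : Set
  IsForest = ¬ Cycle

  data Walk (len : Fin nE → ℕ) : Fin nV → Fin nV → ℕ → Set where
    nil  : ∀ {v} → Walk len v v 0
    cons : ∀ {u w v n} (e : Fin nE) → Joins e u w → Walk len w v n →
           Walk len u v (len e +ℕ n)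

  walkVerts : ∀ {len u v n} → Walk len u v n → List (Fin nV)
  walkVerts {u = u} nil = u ∷ []
  walkVerts {u = u} (cons e _ w) = u ∷ walkVerts w

  -- paths: walks without repeated vertices.  In a forest the path between
  -- two vertices is unique, so  Path len u v n  says  d(u,v) = n.
  Path : (Fin nE → ℕ) → Fin nV → Fin nV → ℕ → Set
  Path len u v n = Σ (Walk len u v n) (λ w → Unique (walkVerts w))

  deg : Fin nV → ℕ
  deg v = Σℕ (λ e → [ src e ≟ᶠ v ]ℕ +ℕ [ tgt e ≟ᶠ v ]ℕ)

record BYForest : Set where
  field
    graph : Graph
  open Graph graph public
  field
    forest  : IsForest graph
    len     : Fin nE → ℕ
    len-pos : ∀ e → 1 ≤ len e
    SV : Fin nV → Bool
    SE : Fin nE → Bool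
    S-sub : ∀ e → SE e ≡ true → (SV (src e) ≡ true × SV (tgt e) ≡ true)
    FV  : Fin nV → Fin nV
    FE  : Fin nE → Fin nE
    FV⁻ : Fin nV → Fin nV
    FE⁻ : Fin nE → Fin nE
    FV-inv₁ : ∀ v → FV (FV⁻ v) ≡ v
    FV-inv₂ : ∀ v → FV⁻ (FV v) ≡ v
    FE-inv₁ : ∀ e → FE (FE⁻ e) ≡ e
    FE-inv₂ : ∀ e → FE⁻ (FE e) ≡ e
    F-hom : ∀ e → Joins graph (FE e) (FV (src e)) (FV (tgt e))
    F-len : ∀ e → len (FE e) ≡ len e
    F-SV  : ∀ v → SV (FV v) ≡ SV v
    F-SE  : ∀ e → SE (FE e) ≡ SE e
    -- Points of T are vertices (inj₁) and open
    -- edges (inj₂); ε is given on points and required to be constant on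
    -- connected components of T ∖ S (its values on points of S are unused).
    ε : Fin nV ⊎ Fin nE → Sign
    ε-const : ∀ e v → SE e ≡ false → SV v ≡ false → Incident graph e v →
              ε (inj₂ e) ≡ ε (inj₁ v)

  Point : Set
  Point = Fin nV ⊎ Fin nE

  Fpt : Point → Point
  Fpt (inj₁ v) = inj₁ (FV v)
  Fpt (inj₂ e) = inj₂ (FE e)

  Outside : Point → Set
  Outside (inj₁ v) = SV v ≡ false
  Outside (inj₂ e) = SE e ≡ false

  data Adj : Point → Point → Set where
    ev : ∀ e v → SE e ≡ false → SV v ≡ false → Incident graph e v →
         Adj (inj₂ e) (inj₁ v)
    ve : ∀ e v → SE e ≡ false → SV v ≡ false → Incident graph e v →
         Adj (inj₁ v) (inj₂ e)

  SameComp : Point → Point → Set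
  SameComp = Star Adj

  -- Λ_T = H₁(T,S;Z) inside the free abelian group on (src→tgt oriented)
  -- edges not in S.

  Chain : Set
  Chain = Fin nE → ℤ

  _+c_ : Chain → Chain → Chain
  (x +c y) e = x e + y e

  ∂ : Chain → Fin nV → ℤ
  ∂ x v = Σℤ (λ e → ([ tgt e ≟ᶠ v ]ℤ + Data.Integer.- [ src e ≟ᶠ v ]ℤ) * x e)

  InΛ : Chain → Set
  InΛ x = (∀ e → SE e ≡ true → x e ≡ 0ℤ) × (∀ v → SV v ≡ false → ∂ x v ≡ 0ℤ)

  ⟪_,_⟫ : Chain → Chain → ℤ
  ⟪ x , y ⟫ = Σℤ (λ e → + len e * (x e * y e))

  orient : Fin nE → ℤ
  orient e = if does (FV (src e) ≟ src (FE e)) then 1ℤ else -1ℤ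

  -- (εF)⁻¹ on chains: σ[e] = ε(C_e)·[F e], hence
  -- (σ⁻¹ y)(e) = ε(C_e) · orient(e) · y(F e)
  σ⁻¹ : Chain → Chain
  σ⁻¹ y e = sgnℤ (ε (inj₂ e)) * (orient e * y (FE e))

-- "Quotient modules": a carrier with a predicate picking out the
-- representatives of elements, an equivalence (the quotient relation),
-- addition, zero and the action of the generator σ = εF.

record QMod : Set₁ where
  field
    Car  : Set
    Good : Car → Set
    _~_  : Car → Car → Set
    _⊕_  : Car → Car → Car
    𝟘    : Car
    act  : Car → Car

record _≅_ (M N : QMod) : Set where
  private
    module M = QMod M
    module N = QMod N
  field
    f : M.Car → N.Car
    g : N.Car → M.Car
    f-good : ∀ {a} → M.Good a → N.Good (f a)
    g-good : ∀ {b} → N.Good b → M.Good (g b)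
    f-cong : ∀ {a a'} → M.Good a → M.Good a' → a M.~ a' → f a N.~ f a'
    g-cong : ∀ {b b'} → N.Good b → N.Good b' → b N.~ b' → g b M.~ g b'
    f-hom  : ∀ {a a'} → M.Good a → M.Good a' → f (a M.⊕ a') N.~ (f a N.⊕ f a')
    gf     : ∀ {a} → M.Good a → g (f a) M.~ a
    fg     : ∀ {b} → N.Good b → f (g b) N.~ b
    f-act  : ∀ {a} → M.Good a → f (M.act a) N.~ N.act (f a)

IsZero : QMod → Set
IsZero M = ∀ {a} → Good a → a ~ 𝟘
  where open QMod M

⨁ : {k : ℕ} → (Fin k → QMod) → QMod
⨁ {k} M = record
  { Car  = (i : Fin k) → QMod.Car (M i)
  ; Good = λ a → ∀ i → QMod.Good (M i) (a i)
  ; _~_  = λ a b → ∀ i → QMod._~_ (M i) (a i) (b i)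
  ; _⊕_  = λ a b i → QMod._⊕_ (M i) (a i) (b i)
  ; 𝟘    = λ i → QMod.𝟘 (M i)
  ; act  = λ a i → QMod.act (M i) (a i)
  }

-- Ind_{σ^q}^{σ} M = Z[σ] ⊗_{Z[σ^q]} M  for q = suc q', written out on the
-- Z[σ^q]-basis 1, σ, …, σ^{q-1} of Z[σ]:  Σ σ^i ⊗ m_i  ↦ (m_0,…,m_{q-1}),
-- and σ·(m_0,…,m_{q-1}) = (σ^q·m_{q-1}, m_0, …, m_{q-2}).
Ind : (q' : ℕ) → QMod → QMod
Ind q' M = record
  { Car  = Fin (suc q') → QMod.Car M
  ; Good = λ a → ∀ i → QMod.Good M (a i)
  ; _~_  = λ a b → ∀ i → QMod._~_ M (a i) (b i)
  ; _⊕_  = λ a b i → QMod._⊕_ M (a i) (b i)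
  ; 𝟘    = λ i → QMod.𝟘 M
  ; act  = shift
  }
  where
    shift : (Fin (suc q') → QMod.Car M) → Fin (suc q') → QMod.Car M
    shift a zero    = QMod.act M (a (fromℕ q'))
    shift a (suc i) = a (inject₁ i)

-- An element of Λ_T^∨ = Hom(Λ_T, Z) is represented by a function on chains
-- which on Λ_T respects (pointwise) equality and is additive; its values off
-- Λ_T are irrelevant.  Two representatives are identified in Λ^∨/Λ iff on
-- Λ_T they differ by ⟪λ , -⟫ for some λ ∈ Λ_T.  σ = εF acts by
-- (σφ)(x) = φ(σ⁻¹ x).

Φ : BYForest → QMod
Φ T = record
  { Car  = Chain → ℤ
  ; Good = λ φ → (∀ x y → InΛ x → InΛ y → (∀ e → x e ≡ y e) → φ x ≡ φ y)
                 × (∀ x y → InΛ x → InΛ y → φ (x +c y) ≡ φ x + φ y)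
  ; _~_  = λ φ ψ → Σ Chain (λ l → InΛ l × (∀ x → InΛ x → φ x ≡ ψ x + ⟪ l , x ⟫))
  ; _⊕_  = λ φ ψ x → φ x + ψ x
  ; 𝟘    = λ x → 0ℤ
  ; act  = λ φ x → φ (σ⁻¹ x)
  }
  where open BYForest T

module _ (T : BYForest) where
  open BYForest T

  Special : Fin nV → Set
  Special v =
      (deg graph v ≡ 1 × SV v ≡ true × (∀ e → Incident graph e v → SE e ≡ false))
    ⊎ (deg graph v ≡ 2 × SV v ≡ false)
    ⊎ (deg graph v ≡ 2 × SV v ≡ true × (∀ e → Incident graph e v → SE e ≡ true))

  ParityA : Set
  ParityA = ∀ u v n → Path graph len u v n → Odd n → Special u ⊎ Special v

  Inverts : ℕ → Fin nE → Set
  Inverts n e = iter FE n e ≡ e × iter FV n (src e) ≡ tgt e × iter FV n (tgt e) ≡ src e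

  ParityB : Set
  ParityB = ∀ n e → Inverts (suc n) e → ¬ Odd (len e)

-- (1) T₀ is (isomorphic to) the disjoint union of the closures of the
-- components of T ∖ S, with S₀ = preimage of S and the induced signed
-- automorphism; π : T₀ → T is the canonical map.
record ClosureSplitting (T₀ T : BYForest) : Set where
  private
    module T  = BYForest T
    module T₀ = BYForest T₀
  field
    πV : Fin T₀.nV → Fin T.nV
    πE : Fin T₀.nE → Fin T.nE
    π-src : ∀ e → πV (T₀.src e) ≡ T.src (πE e)
    π-tgt : ∀ e → πV (T₀.tgt e) ≡ T.tgt (πE e)
    π-len : ∀ e → T₀.len e ≡ T.len (πE e)
    π-SV  : ∀ v → T₀.SV v ≡ T.SV (πV v)
    π-SE  : ∀ e → T₀.SE e ≡ T.SE (πE e)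
    πE-inj  : Injective _≡_ _≡_ πE
    πE-out  : ∀ e → T.SE (πE e) ≡ false
    πE-surj : ∀ e → T.SE e ≡ false → Σ (Fin T₀.nE) (λ e₀ → πE e₀ ≡ e)
    πV-inj-out : ∀ v w → T₀.SV v ≡ false → πV v ≡ πV w → v ≡ w
    πV-surj-out : ∀ v → T.SV v ≡ false → Σ (Fin T₀.nV) (λ v₀ → πV v₀ ≡ v)
    -- vertices of T₀ in S₀: one copy of v ∈ S for each component C of T ∖ S
    -- whose closure contains v
    S₀-nonisolated : ∀ v → T₀.SV v ≡ true →
                     Σ (Fin T₀.nE) (λ e → Incident T₀.graph e v)
    S₀-copies : ∀ v w e d → T₀.SV v ≡ true → T₀.SV w ≡ true → πV v ≡ πV w →
                Incident T₀.graph e v → Incident T₀.graph d w →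
                (v ≡ w → T.SameComp (inj₂ (πE e)) (inj₂ (πE d)))
                × (T.SameComp (inj₂ (πE e)) (inj₂ (πE d)) → v ≡ w)
    π-FV : ∀ v → πV (T₀.FV v) ≡ T.FV (πV v)
    π-FE : ∀ e → πE (T₀.FE e) ≡ T.FE (πE e)
    π-εV : ∀ v → T₀.SV v ≡ false → T₀.ε (inj₁ v) ≡ T.ε (inj₁ (πV v))
    π-εE : ∀ e → T₀.SE e ≡ false → T₀.ε (inj₂ e) ≡ T.ε (inj₂ (πE e))

-- an embedding of BY forests T' ↪ T as a sub-BY-forest with the induced
-- structure (S' = S ∩ T', F' = F|T', ε' = ε|T'); F-stability of the image
-- is expressed by ι ∘ F' = F ∘ ι.
record SubEmbedding (T' T : BYForest) : Set where
  private
    module T  = BYForest T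
    module T' = BYForest T'
  field
    ιV : Fin T'.nV → Fin T.nV
    ιE : Fin T'.nE → Fin T.nE
    ιV-inj : Injective _≡_ _≡_ ιV
    ιE-inj : Injective _≡_ _≡_ ιE
    ι-src : ∀ e → ιV (T'.src e) ≡ T.src (ιE e)
    ι-tgt : ∀ e → ιV (T'.tgt e) ≡ T.tgt (ιE e)
    ι-len : ∀ e → T'.len e ≡ T.len (ιE e)
    ι-SV  : ∀ v → T'.SV v ≡ T.SV (ιV v)
    ι-SE  : ∀ e → T'.SE e ≡ T.SE (ιE e)
    ι-FV  : ∀ v → ιV (T'.FV v) ≡ T.FV (ιV v)
    ι-FE  : ∀ e → ιE (T'.FE e) ≡ T.FE (ιE e)
    ι-εV  : ∀ v → T'.SV v ≡ false → T'.ε (inj₁ v) ≡ T.ε (inj₁ (ιV v))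
    ι-εE  : ∀ e → T'.SE e ≡ false → T'.ε (inj₂ e) ≡ T.ε (inj₂ (ιE e))

record DisjointUnion (T : BYForest) {k : ℕ} (Ts : Fin k → BYForest) : Set where
  private
    module T = BYForest T
    module Ts (i : Fin k) = BYForest (Ts i)
  field
    emb : ∀ i → SubEmbedding (Ts i) T
  private
    module E (i : Fin k) = SubEmbedding (emb i)
  field
    coverV : ∀ v → Σ (Fin k) (λ i → Σ (Fin (Ts.nV i)) (λ w → E.ιV i w ≡ v))
    coverE : ∀ e → Σ (Fin k) (λ i → Σ (Fin (Ts.nE i)) (λ d → E.ιE i d ≡ e))
    disjV  : ∀ i j v w → E.ιV i v ≡ E.ιV j w → i ≡ j
    disjE  : ∀ i j e d → E.ιE i e ≡ E.ιE j d → i ≡ j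

-- T is connected and nonempty (a tree, given that T is a forest)
IsTree : BYForest → Set
IsTree T = Fin nV × (∀ u v → Σ ℕ (λ n → Walk graph len u v n))
  where open BYForest T

-- (3) T is a single F-orbit of the q = suc q' trees T₀, F T₀, …, F^{q-1} T₀,
-- where T₀ carries S ∩ T₀ and the signed automorphism (εF)^q|T₀.
record SingleOrbit (T T₀ : BYForest) (q' : ℕ) : Set where
  private
    module T  = BYForest T
    module T₀ = BYForest T₀
    q = suc q'
  field
    tree : IsTree T₀
    ιV : Fin T₀.nV → Fin T.nV
    ιE : Fin T₀.nE → Fin T.nE
    ι-src : ∀ e → ιV (T₀.src e) ≡ T.src (ιE e)
    ι-tgt : ∀ e → ιV (T₀.tgt e) ≡ T.tgt (ιE e)
    ι-len : ∀ e → T₀.len e ≡ T.len (ιE e)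
    ι-SV  : ∀ v → T₀.SV v ≡ T.SV (ιV v)
    ι-SE  : ∀ e → T₀.SE e ≡ T.SE (ιE e)
    coverV : ∀ v → Σ (Fin q) (λ i → Σ (Fin T₀.nV) (λ w →
               iter T.FV (Data.Fin.toℕ i) (ιV w) ≡ v))
    coverE : ∀ e → Σ (Fin q) (λ i → Σ (Fin T₀.nE) (λ d →
               iter T.FE (Data.Fin.toℕ i) (ιE d) ≡ e))
    uniqV  : ∀ (i j : Fin q) v w →
             iter T.FV (Data.Fin.toℕ i) (ιV v) ≡ iter T.FV (Data.Fin.toℕ j) (ιV w) →
             i ≡ j × v ≡ w
    uniqE  : ∀ (i j : Fin q) e d →
             iter T.FE (Data.Fin.toℕ i) (ιE e) ≡ iter T.FE (Data.Fin.toℕ j) (ιE d) →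
             i ≡ j × e ≡ d
    ι-FV : ∀ v → ιV (T₀.FV v) ≡ iter T.FV q (ιV v)
    ι-FE : ∀ e → ιE (T₀.FE e) ≡ iter T.FE q (ιE e)
    -- the sign of (εF)^q on a component C is ∏_{i<q} ε(F^i C)
    ι-εV : ∀ v → T₀.SV v ≡ false → T₀.ε (inj₁ v) ≡
             Πˢ (λ (i : Fin q) → T.ε (iter T.Fpt (Data.Fin.toℕ i) (inj₁ (ιV v))))
    ι-εE : ∀ e → T₀.SE e ≡ false → T₀.ε (inj₂ e) ≡
             Πˢ (λ (i : Fin q) → T.ε (iter T.Fpt (Data.Fin.toℕ i) (inj₂ (ιE e))))

EmptyS : BYForest → Set
EmptyS T = (∀ v → SV v ≡ false) × (∀ e → SE e ≡ false)
  where open BYForest T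

FullS : BYForest → Set
FullS T = (∀ v → SV v ≡ true) × (∀ e → SE e ≡ true)
  where open BYForest T

-- Parts (1)–(3) are instances of one principle.  Suppose that every edge of T outside S is,
-- in exactly one way, the image jᵢ(d) of an edge d of a piece Tᵢ, and fix signs sᵢ(d) = ±1.
-- Pushing chains forward, x ↦ Σ_d sᵢ(d) x(d) [jᵢ d], and pulling them back,
-- y ↦ (d ↦ sᵢ(d) y(jᵢ d)), are adjoint for the length pairings and inverse to each other, so
-- whenever both preserve the lattices Λ they give an isometry Λ_T ≅ ⊕ Λ_{Tᵢ}, and dualising
-- gives Λ_T^∨/Λ_T ≅ ⊕ Λ_{Tᵢ}^∨/Λ_{Tᵢ}.  In (1) and (2) the jᵢ are inclusions commuting with εF
-- and all signs are +1.  In (3) the pieces are the translates Fⁱ T₀ with the signs of (εF)ⁱ,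
-- so εF moves the i-th summand to the (i+1)-st and brings the last one back to T₀ as (εF)^q:
-- this is the induced module.  The parity conditions pull back because these maps preserve
-- lengths, degrees and paths; in (1) a path of T₀ stays a path in T because distinct copies
-- of a vertex of S lie in distinct components of T ∖ S.
-- For (4), S = T forces Λ = 0; for S = ∅ a nonzero cycle on a forest would let one walk
-- forever along edges with nonzero coefficient without backtracking, which closes a cycle.

module Submission where

open import Defs
import Algebra.Properties.Semiring.Sum as SemiringSum
open import Data.Bool using (true; false; if_then_else_)
open import Data.Bool.Properties using (¬-not)
open import Data.Empty using (⊥-elim)
open import Data.Fin using (Fin; zero; suc; toℕ; fromℕ; fromℕ<; inject₁)
open import Data.Fin.Properties
  using (_≟_; any?; suc-injective; toℕ-fromℕ; toℕ-fromℕ<; toℕ-inject; toℕ-inject₁; toℕ<n; toℕ-injective; inject₁-injective; pigeonhole; ¬∀⟶∃¬-smallest)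
open import Data.Fin.Permutation using (permutation)
open import Data.Integer as ℤ using (ℤ; 0ℤ; 1ℤ; -1ℤ; _+_; _*_; -_)
open import Data.Integer.Properties hiding (_≟_)
open import Data.Integer.Solver using (module +-*-Solver)
open import Data.Nat as ℕ using (ℕ; zero; suc)
import Data.Nat.Properties as ℕₚ
import Data.List as List
open import Data.List using (_∷_)
open import Data.List.Relation.Unary.Unique.Propositional using (Unique)
import Data.List.Relation.Unary.Unique.Propositional.Properties as Uniqueₚ
open import Data.List.Membership.Propositional using (_∈_)
open import Data.List.Relation.Unary.Any using (here; there)
open import Data.List.Relation.Unary.All as All using ([])
import Data.List.Relation.Unary.All.Properties as Allₚ
open import Data.List.Relation.Unary.AllPairs using ([]; _∷_)
open import Relation.Binary.Construct.Closure.ReflexiveTransitive using (_◅_; _◅◅_) renaming (ε to ε⋆)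
open import Data.Product using (Σ; _×_; _,_; proj₁; proj₂)
open import Data.Sign using (Sign)
open import Data.Sum using (_⊎_; inj₁; inj₂)
open import Function.Definitions using (Injective)
open import Relation.Nullary using (¬_; Dec; does; yes; no)
open import Relation.Nullary.Decidable using (¬?; _×-dec_; _⊎-dec_; decidable-stable)
open import Relation.Binary.Definitions using (tri<; tri≈; tri>)
open import Relation.Binary.PropositionalEquality

open import Algebra.Properties.AbelianGroup +-0-abelianGroup using (identityʳ-unique)
open SemiringSum +-*-semiring using (sum; sum-cong-≗; ∑-distrib-+; ∑-comm; *-distribˡ-sum; sum-permute)

δ-≡ : ∀ {n} {a b : Fin n} → a ≡ b → [ a ≟ᶠ b ]ℤ ≡ 1ℤ
δ-≡ {a = a} {b} a≡b with a ≟ b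
... | yes _   = refl
... | no a≢b = ⊥-elim (a≢b a≡b)

δ-≢ : ∀ {n} {a b : Fin n} → a ≢ b → [ a ≟ᶠ b ]ℤ ≡ 0ℤ
δ-≢ {a = a} {b} a≢b with a ≟ b
... | yes a≡b = ⊥-elim (a≢b a≡b)
... | no _    = refl

δ-map : ∀ {m n} {f : Fin m → Fin n} {b} → (∀ a → f a ≡ f b → a ≡ b) →
        ∀ a → [ f a ≟ᶠ f b ]ℤ ≡ [ a ≟ᶠ b ]ℤ
δ-map {f = f} {b} inj-at-b a with a ≟ b
... | yes a≡b = δ-≡ (cong f a≡b)
... | no a≢b  = δ-≢ (λ fa≡fb → a≢b (inj-at-b a fa≡fb))

δ*-cong : ∀ {n} {a b : Fin n} {u v : ℤ} → (a ≡ b → u ≡ v) → [ a ≟ᶠ b ]ℤ * u ≡ [ a ≟ᶠ b ]ℤ * v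
δ*-cong {a = a} {b} u≡v with a ≟ b
... | yes a≡b = cong (1ℤ *_) (u≡v a≡b)
... | no _    = refl

δ*-vanish : ∀ {n} {a b : Fin n} {u : ℤ} → (a ≡ b → u ≡ 0ℤ) → [ a ≟ᶠ b ]ℤ * u ≡ 0ℤ
δ*-vanish {a = a} {b} {u} u≡0 = trans (δ*-cong u≡0) (*-zeroʳ [ a ≟ᶠ b ]ℤ)

Σℤ≡sum : ∀ {n} (f : Fin n → ℤ) → Σℤ f ≡ sum f
Σℤ≡sum {zero}  f = refl
Σℤ≡sum {suc n} f = cong (f zero +_) (Σℤ≡sum (λ i → f (suc i)))

Σℤ-cong : ∀ {n} {f g : Fin n → ℤ} → (∀ i → f i ≡ g i) → Σℤ f ≡ Σℤ g
Σℤ-cong {f = f} {g} f≗g = trans (Σℤ≡sum f) (trans (sum-cong-≗ f≗g) (sym (Σℤ≡sum g)))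

Σℤ-distrib-+ : ∀ {n} (f g : Fin n → ℤ) → Σℤ (λ i → f i + g i) ≡ Σℤ f + Σℤ g
Σℤ-distrib-+ f g = begin
  Σℤ (λ i → f i + g i)  ≡⟨ Σℤ≡sum (λ i → f i + g i) ⟩
  sum (λ i → f i + g i) ≡⟨ ∑-distrib-+ f g ⟩
  sum f + sum g         ≡⟨ cong₂ _+_ (Σℤ≡sum f) (Σℤ≡sum g) ⟨
  Σℤ f + Σℤ g           ∎
  where open ≡-Reasoning

Σℤ-*ˡ : ∀ {n} (c : ℤ) (f : Fin n → ℤ) → Σℤ (λ i → c * f i) ≡ c * Σℤ f
Σℤ-*ˡ c f = begin
  Σℤ (λ i → c * f i)  ≡⟨ Σℤ≡sum (λ i → c * f i) ⟩
  sum (λ i → c * f i) ≡⟨ *-distribˡ-sum c f ⟨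
  c * sum f           ≡⟨ cong (c *_) (Σℤ≡sum f) ⟨
  c * Σℤ f            ∎
  where open ≡-Reasoning

Σℤ-*ʳ : ∀ {n} (c : ℤ) (f : Fin n → ℤ) → Σℤ (λ i → f i * c) ≡ Σℤ f * c
Σℤ-*ʳ c f = trans (Σℤ-cong (λ i → *-comm (f i) c)) (trans (Σℤ-*ˡ c f) (*-comm c _))

Σℤ-comm : ∀ {m n} (f : Fin m → Fin n → ℤ) →
          Σℤ (λ i → Σℤ (λ j → f i j)) ≡ Σℤ (λ j → Σℤ (λ i → f i j))
Σℤ-comm f = begin
  Σℤ (λ i → Σℤ (λ j → f i j))   ≡⟨ Σℤ-cong (λ i → Σℤ≡sum (f i)) ⟩
  Σℤ (λ i → sum (λ j → f i j))  ≡⟨ Σℤ≡sum (λ i → sum (λ j → f i j)) ⟩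
  sum (λ i → sum (λ j → f i j)) ≡⟨ ∑-comm f ⟩
  sum (λ j → sum (λ i → f i j)) ≡⟨ Σℤ≡sum (λ j → sum (λ i → f i j)) ⟨
  Σℤ (λ j → sum (λ i → f i j))  ≡⟨ Σℤ-cong (λ j → Σℤ≡sum (λ i → f i j)) ⟨
  Σℤ (λ j → Σℤ (λ i → f i j))   ∎
  where open ≡-Reasoning

Σℤ-zero : ∀ {n} {f : Fin n → ℤ} → (∀ i → f i ≡ 0ℤ) → Σℤ f ≡ 0ℤ
Σℤ-zero {zero}  f≗0 = refl
Σℤ-zero {suc n} f≗0 = cong₂ _+_ (f≗0 zero) (Σℤ-zero (λ i → f≗0 (suc i)))

Σℤ-single : ∀ {n} (a : Fin n) {f : Fin n → ℤ} → (∀ i → i ≢ a → f i ≡ 0ℤ) → Σℤ f ≡ f a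
Σℤ-single zero    {f} off = trans (cong (f zero +_) (Σℤ-zero (λ i → off (suc i) (λ ())))) (+-identityʳ _)
Σℤ-single (suc a) {f} off =
  trans (cong (_+ Σℤ (λ i → f (suc i))) (off zero (λ ())))
        (trans (+-identityˡ _) (Σℤ-single a (λ i i≢a → off (suc i) (λ si≡sa → i≢a (suc-injective si≡sa)))))

Σℤ-δ : ∀ {n} (a : Fin n) (f : Fin n → ℤ) → Σℤ (λ i → [ a ≟ᶠ i ]ℤ * f i) ≡ f a
Σℤ-δ a f = trans (Σℤ-single a (λ i i≢a → trans (cong (_* f i) (δ-≢ (λ a≡i → i≢a (sym a≡i)))) refl))
                 (trans (cong (_* f a) (δ-≡ {a = a} refl)) (*-identityˡ (f a)))

Σℤ-permute : ∀ {n} (π π⁻ : Fin n → Fin n) → (∀ i → π (π⁻ i) ≡ i) → (∀ i → π⁻ (π i) ≡ i) →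
             (f : Fin n → ℤ) → Σℤ f ≡ Σℤ (λ i → f (π i))
Σℤ-permute π π⁻ inv₁ inv₂ f = begin
  Σℤ f                 ≡⟨ Σℤ≡sum f ⟩
  sum f                ≡⟨ sum-permute f (permutation π π⁻ inv₁ inv₂) ⟩
  sum (λ i → f (π i))  ≡⟨ Σℤ≡sum (λ i → f (π i)) ⟨
  Σℤ (λ i → f (π i))   ∎
  where open ≡-Reasoning

Σℤ-reindex : ∀ {m n} (j : Fin n → Fin m) → Injective _≡_ _≡_ j → (h : Fin m → ℤ) →
             (∀ e → h e ≢ 0ℤ → Σ (Fin n) (λ d → j d ≡ e)) → Σℤ h ≡ Σℤ (λ d → h (j d))
Σℤ-reindex j j-inj h supp = begin
  Σℤ h                                        ≡⟨ Σℤ-cong spread ⟩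
  Σℤ (λ e → Σℤ (λ d → [ j d ≟ᶠ e ]ℤ * h e))   ≡⟨ Σℤ-comm (λ e d → [ j d ≟ᶠ e ]ℤ * h e) ⟩
  Σℤ (λ d → Σℤ (λ e → [ j d ≟ᶠ e ]ℤ * h e))   ≡⟨ Σℤ-cong (λ d → Σℤ-δ (j d) h) ⟩
  Σℤ (λ d → h (j d))                          ∎
  where
  open ≡-Reasoning
  spread : ∀ e → h e ≡ Σℤ (λ d → [ j d ≟ᶠ e ]ℤ * h e)
  spread e with h e ℤ.≟ 0ℤ
  ... | yes he≡0 = trans he≡0 (sym (Σℤ-zero (λ d → trans (cong ([ j d ≟ᶠ e ]ℤ *_) he≡0) (*-zeroʳ [ j d ≟ᶠ e ]ℤ))))
  ... | no he≢0 with supp e he≢0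
  ... | d₀ , jd₀≡e = sym (begin
    Σℤ (λ d → [ j d ≟ᶠ e ]ℤ * h e) ≡⟨ Σℤ-single d₀ (λ d d≢d₀ → cong (_* h e)
                                        (δ-≢ (λ jd≡e → d≢d₀ (j-inj (trans jd≡e (sym jd₀≡e)))))) ⟩
    [ j d₀ ≟ᶠ e ]ℤ * h e           ≡⟨ cong (_* h e) (δ-≡ jd₀≡e) ⟩
    1ℤ * h e                       ≡⟨ *-identityˡ (h e) ⟩
    h e                            ∎)

Σℤ-mono-≤ : ∀ {n} {f g : Fin n → ℤ} → (∀ i → f i ℤ.≤ g i) → Σℤ f ℤ.≤ Σℤ g
Σℤ-mono-≤ {zero}  f≤g = ≤-refl
Σℤ-mono-≤ {suc n} f≤g = +-mono-≤ (f≤g zero) (Σℤ-mono-≤ (λ i → f≤g (suc i)))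

+Σℕ≡Σℤ+ : ∀ {n} (f : Fin n → ℕ) → ℤ.+ Σℕ f ≡ Σℤ (λ i → ℤ.+ f i)
+Σℕ≡Σℤ+ {zero}  f = refl
+Σℕ≡Σℤ+ {suc n} f = trans (pos-+ (f zero) (Σℕ (λ i → f (suc i)))) (cong (ℤ.+ f zero +_) (+Σℕ≡Σℤ+ (λ i → f (suc i))))

Σℤ-injective-≤ : ∀ {m n} (j : Fin n → Fin m) → Injective _≡_ _≡_ j → (h : Fin m → ℤ) →
                 (∀ e → 0ℤ ℤ.≤ h e) → Σℤ (λ d → h (j d)) ℤ.≤ Σℤ h
Σℤ-injective-≤ {m} j j-inj h h≥0 = begin
  Σℤ (λ d → h (j d))      ≡⟨ Σℤ-cong (λ d → sym (onImage-j d)) ⟩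
  Σℤ (λ d → onImage (j d)) ≡⟨ Σℤ-reindex j j-inj onImage onImage-supp ⟨
  Σℤ onImage              ≤⟨ Σℤ-mono-≤ onImage≤h ⟩
  Σℤ h                    ∎
  where
  open ≤-Reasoning
  onImage : Fin m → ℤ
  onImage e with any? (λ d → j d ≟ e)
  ... | yes _ = h e
  ... | no _  = 0ℤ
  onImage-j : ∀ d → onImage (j d) ≡ h (j d)
  onImage-j d with any? (λ d' → j d' ≟ j d)
  ... | yes _ = refl
  ... | no ∄ = ⊥-elim (∄ (d , refl))
  onImage-supp : ∀ e → onImage e ≢ 0ℤ → Σ _ (λ d → j d ≡ e)
  onImage-supp e ≢0 with any? (λ d → j d ≟ e)
  ... | yes ∃d = ∃d
  ... | no _  = ⊥-elim (≢0 refl)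
  onImage≤h : ∀ e → onImage e ℤ.≤ h e
  onImage≤h e with any? (λ d → j d ≟ e)
  ... | yes _ = ≤-refl
  ... | no _  = h≥0 e

sgnℤ*sgnℤ≡1 : ∀ s → sgnℤ s * sgnℤ s ≡ 1ℤ
sgnℤ*sgnℤ≡1 Sign.+ = refl
sgnℤ*sgnℤ≡1 Sign.- = refl

sgnℤ-* : ∀ s t → sgnℤ (s Data.Sign.* t) ≡ sgnℤ s * sgnℤ t
sgnℤ-* Sign.+ Sign.+ = refl
sgnℤ-* Sign.+ Sign.- = refl
sgnℤ-* Sign.- Sign.+ = refl
sgnℤ-* Sign.- Sign.- = refl

unit*z≡0⇒z≡0 : ∀ u z → u * u ≡ 1ℤ → u * z ≡ 0ℤ → z ≡ 0ℤ
unit*z≡0⇒z≡0 u z u²≡1 uz≡0 = begin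
  z           ≡⟨ *-identityˡ z ⟨
  1ℤ * z      ≡⟨ cong (_* z) u²≡1 ⟨
  u * u * z   ≡⟨ *-assoc u u z ⟩
  u * (u * z) ≡⟨ cong (u *_) uz≡0 ⟩
  u * 0ℤ      ≡⟨ *-zeroʳ u ⟩
  0ℤ          ∎
  where open ≡-Reasoning

module Chains (T : BYForest) where
  open BYForest T
  open QMod (Φ T) using (Good; _~_)

  src≢tgt : ∀ e → src e ≢ tgt e
  src≢tgt e src≡tgt = forest record
    { k = 0 ; vs = ends ; es = λ _ → e ; closed = src≡tgt
    ; vs-inj = λ { {zero} {zero} _ → refl }
    ; es-inj = λ { {zero} {zero} _ → refl }
    ; joins = λ { zero → inj₁ (refl , refl) } }
    where
    ends : Fin 2 → Fin nV
    ends zero    = src e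
    ends (suc _) = tgt e

  FV-injective : Injective _≡_ _≡_ FV
  FV-injective {a} {b} p = trans (sym (FV-inv₂ a)) (trans (cong FV⁻ p) (FV-inv₂ b))

  FE-injective : Injective _≡_ _≡_ FE
  FE-injective {a} {b} p = trans (sym (FE-inv₂ a)) (trans (cong FE⁻ p) (FE-inv₂ b))

  Orientation : Fin nE → Set
  Orientation e = (orient e ≡ 1ℤ  × FV (src e) ≡ src (FE e) × FV (tgt e) ≡ tgt (FE e))
                ⊎ (orient e ≡ -1ℤ × FV (src e) ≡ tgt (FE e) × FV (tgt e) ≡ src (FE e))

  orientation : ∀ e → Orientation e
  orientation e = go (FV (src e) ≟ src (FE e)) refl (F-hom e)
    where
    go : (d : Dec (FV (src e) ≡ src (FE e))) → (if does d then 1ℤ else -1ℤ) ≡ orient e →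
         Joins graph (FE e) (FV (src e)) (FV (tgt e)) → Orientation e
    go (yes p) o (inj₁ (_ , q)) = inj₁ (sym o , p , sym q)
    go (yes p) o (inj₂ (q , _)) = ⊥-elim (src≢tgt e (FV-injective (trans p q)))
    go (no ¬p) o (inj₁ (q , _)) = ⊥-elim (¬p (sym q))
    go (no ¬p) o (inj₂ (q , r)) = inj₂ (sym o , sym r , sym q)

  orient*orient≡1 : ∀ e → orient e * orient e ≡ 1ℤ
  orient*orient≡1 e with orientation e
  ... | inj₁ (o , _) = cong₂ _*_ o o
  ... | inj₂ (o , _) = cong₂ _*_ o o

  inc : Fin nE → Fin nV → ℤ
  inc e v = [ tgt e ≟ᶠ v ]ℤ + - [ src e ≟ᶠ v ]ℤ

  orient*inc≡inc-F : ∀ e v → orient e * inc e v ≡ inc (FE e) (FV v)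
  orient*inc≡inc-F e v with orientation e
  ... | inj₁ (o , s , t) = begin
    orient e * inc e v                                  ≡⟨ cong (_* inc e v) o ⟩
    1ℤ * inc e v                                        ≡⟨ *-identityˡ (inc e v) ⟩
    [ tgt e ≟ᶠ v ]ℤ + - [ src e ≟ᶠ v ]ℤ                 ≡⟨ cong₂ (λ a b → a + - b) (δ-F (tgt e)) (δ-F (src e)) ⟨
    [ FV (tgt e) ≟ᶠ FV v ]ℤ + - [ FV (src e) ≟ᶠ FV v ]ℤ ≡⟨ cong₂ (λ a b → [ a ≟ᶠ FV v ]ℤ + - [ b ≟ᶠ FV v ]ℤ) t s ⟩
    inc (FE e) (FV v)                                   ∎
    where
    open ≡-Reasoning
    δ-F : ∀ a → [ FV a ≟ᶠ FV v ]ℤ ≡ [ a ≟ᶠ v ]ℤ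
    δ-F a = δ-map (λ _ → FV-injective) a
  ... | inj₂ (o , s , t) = begin
    orient e * inc e v                                  ≡⟨ cong (_* inc e v) o ⟩
    -1ℤ * inc e v                                       ≡⟨ solve 2 (λ a b → con -1ℤ :* (a :- b) := b :- a) refl
                                                             [ tgt e ≟ᶠ v ]ℤ [ src e ≟ᶠ v ]ℤ ⟩
    [ src e ≟ᶠ v ]ℤ + - [ tgt e ≟ᶠ v ]ℤ                 ≡⟨ cong₂ (λ a b → a + - b) (δ-F (src e)) (δ-F (tgt e)) ⟨
    [ FV (src e) ≟ᶠ FV v ]ℤ + - [ FV (tgt e) ≟ᶠ FV v ]ℤ ≡⟨ cong₂ (λ a b → [ a ≟ᶠ FV v ]ℤ + - [ b ≟ᶠ FV v ]ℤ) s t ⟩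
    inc (FE e) (FV v)                                   ∎
    where
    open ≡-Reasoning
    open +-*-Solver
    δ-F : ∀ a → [ FV a ≟ᶠ FV v ]ℤ ≡ [ a ≟ᶠ v ]ℤ
    δ-F a = δ-map (λ _ → FV-injective) a

  Σℤ-FE : (h : Fin nE → ℤ) → Σℤ h ≡ Σℤ (λ e → h (FE e))
  Σℤ-FE = Σℤ-permute FE FE⁻ FE-inv₁ FE-inv₂

  incident-or-inc≡0 : ∀ e v → Incident graph e v ⊎ inc e v ≡ 0ℤ
  incident-or-inc≡0 e v with src e ≟ v | tgt e ≟ v
  ... | yes p | _     = inj₁ (inj₁ p)
  ... | no _  | yes q = inj₁ (inj₂ q)
  ... | no _  | no _  = inj₂ refl

  incident-outside : ∀ e v → SV v ≡ false → Incident graph e v → SE e ≡ false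
  incident-outside e v v∉S e∋v = ¬-not (λ e∈S → true≢false (trans (sym (endpoint-in-S e∈S e∋v)) v∉S))
    where
    true≢false : true ≢ false
    true≢false ()
    endpoint-in-S : SE e ≡ true → Incident graph e v → SV v ≡ true
    endpoint-in-S e∈S (inj₁ refl) = proj₁ (S-sub e e∈S)
    endpoint-in-S e∈S (inj₂ refl) = proj₂ (S-sub e e∈S)

  0c : Chain
  0c _ = 0ℤ

  ΣC : ∀ {k} → (Fin k → Chain) → Chain
  ΣC y e = Σℤ (λ i → y i e)

  InΛ-cong : ∀ {x y} → (∀ e → x e ≡ y e) → InΛ x → InΛ y
  InΛ-cong x≗y (x∈S⇒0 , ∂x≡0) =
    (λ e e∈S → trans (sym (x≗y e)) (x∈S⇒0 e e∈S)) ,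
    (λ v v∉S → trans (Σℤ-cong (λ e → cong (inc e v *_) (sym (x≗y e)))) (∂x≡0 v v∉S))

  0c-InΛ : InΛ 0c
  0c-InΛ = (λ _ _ → refl) , (λ v _ → Σℤ-zero (λ e → *-zeroʳ (inc e v)))

  ∂-+ : ∀ x y v → ∂ (x +c y) v ≡ ∂ x v + ∂ y v
  ∂-+ x y v = trans (Σℤ-cong (λ e → *-distribˡ-+ (inc e v) (x e) (y e)))
                    (Σℤ-distrib-+ (λ e → inc e v * x e) (λ e → inc e v * y e))

  +c-InΛ : ∀ {x y} → InΛ x → InΛ y → InΛ (x +c y)
  +c-InΛ {x} {y} (x∈S⇒0 , ∂x≡0) (y∈S⇒0 , ∂y≡0) =
    (λ e e∈S → cong₂ _+_ (x∈S⇒0 e e∈S) (y∈S⇒0 e e∈S)) ,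
    (λ v v∉S → trans (∂-+ x y v) (cong₂ _+_ (∂x≡0 v v∉S) (∂y≡0 v v∉S)))

  ΣC-InΛ : ∀ {k} (y : Fin k → Chain) → (∀ i → InΛ (y i)) → InΛ (ΣC y)
  ΣC-InΛ {zero}  y y∈Λ = 0c-InΛ
  ΣC-InΛ {suc k} y y∈Λ = +c-InΛ (y∈Λ zero) (ΣC-InΛ (λ i → y (suc i)) (λ i → y∈Λ (suc i)))

  ⟪0c,x⟫≡0 : ∀ x → ⟪ 0c , x ⟫ ≡ 0ℤ
  ⟪0c,x⟫≡0 x = Σℤ-zero (λ e → *-zeroʳ (ℤ.+ len e))

  ⟪⟫-comm : ∀ x y → ⟪ x , y ⟫ ≡ ⟪ y , x ⟫
  ⟪⟫-comm x y = Σℤ-cong (λ e → cong (ℤ.+ len e *_) (*-comm (x e) (y e)))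

  ⟪ΣC,x⟫ : ∀ {k} (y : Fin k → Chain) x → ⟪ ΣC y , x ⟫ ≡ Σℤ (λ i → ⟪ y i , x ⟫)
  ⟪ΣC,x⟫ y x = trans
    (Σℤ-cong (λ e → trans (cong (ℤ.+ len e *_) (sym (Σℤ-*ʳ (x e) (λ i → y i e))))
                          (sym (Σℤ-*ˡ (ℤ.+ len e) (λ i → y i e * x e)))))
    (Σℤ-comm (λ e i → ℤ.+ len e * (y i e * x e)))

  Good-0c : ∀ {φ} → Good φ → φ 0c ≡ 0ℤ
  Good-0c {φ} (resp , additive) = identityʳ-unique (φ 0c) (φ 0c) (sym (begin
    φ 0c          ≡⟨ resp 0c (0c +c 0c) 0c-InΛ (+c-InΛ 0c-InΛ 0c-InΛ) (λ _ → refl) ⟩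
    φ (0c +c 0c)  ≡⟨ additive 0c 0c 0c-InΛ 0c-InΛ ⟩
    φ 0c + φ 0c   ∎))
    where open ≡-Reasoning

  Good-zero : ∀ {φ} → Good φ → ∀ x → InΛ x → (∀ e → x e ≡ 0ℤ) → φ x ≡ 0ℤ
  Good-zero G x x∈Λ x≗0 = trans (proj₁ G x 0c x∈Λ 0c-InΛ x≗0) (Good-0c G)

  Good-ΣC : ∀ {φ} → Good φ → ∀ {k} (y : Fin k → Chain) → (∀ i → InΛ (y i)) →
            φ (ΣC y) ≡ Σℤ (λ i → φ (y i))
  Good-ΣC G {zero}  y y∈Λ = Good-0c G
  Good-ΣC {φ} G {suc k} y y∈Λ =
    trans (proj₂ G (y zero) (ΣC (λ i → y (suc i))) (y∈Λ zero) (ΣC-InΛ (λ i → y (suc i)) (λ i → y∈Λ (suc i))))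
          (cong (φ (y zero) +_) (Good-ΣC G (λ i → y (suc i)) (λ i → y∈Λ (suc i))))

  ~-of-≡ : ∀ {φ ψ} → (∀ x → InΛ x → φ x ≡ ψ x) → φ ~ ψ
  ~-of-≡ {φ} {ψ} φ≡ψ = 0c , 0c-InΛ ,
    (λ x x∈Λ → trans (φ≡ψ x x∈Λ) (sym (trans (cong (ψ x +_) (⟪0c,x⟫≡0 x)) (+-identityʳ (ψ x)))))

  ∂-Σδ : ∀ {m} (j : Fin m → Fin nE) (y : Fin m → ℤ) v →
         ∂ (λ e → Σℤ (λ d → [ j d ≟ᶠ e ]ℤ * y d)) v ≡ Σℤ (λ d → inc (j d) v * y d)
  ∂-Σδ j y v = begin
    Σℤ (λ e → inc e v * Σℤ (λ d → [ j d ≟ᶠ e ]ℤ * y d))   ≡⟨ Σℤ-cong (λ e → sym (Σℤ-*ˡ (inc e v) (λ d → [ j d ≟ᶠ e ]ℤ * y d))) ⟩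
    Σℤ (λ e → Σℤ (λ d → inc e v * ([ j d ≟ᶠ e ]ℤ * y d))) ≡⟨ Σℤ-comm (λ e d → inc e v * ([ j d ≟ᶠ e ]ℤ * y d)) ⟩
    Σℤ (λ d → Σℤ (λ e → inc e v * ([ j d ≟ᶠ e ]ℤ * y d))) ≡⟨ Σℤ-cong (λ d → trans (Σℤ-cong (λ e → x*[δ*y]≡δ*[x*y] (inc e v) [ j d ≟ᶠ e ]ℤ (y d)))
                                                                                     (Σℤ-δ (j d) (λ e → inc e v * y d))) ⟩
    Σℤ (λ d → inc (j d) v * y d)                           ∎
    where
    open ≡-Reasoning
    x*[δ*y]≡δ*[x*y] : ∀ a b c → a * (b * c) ≡ b * (a * c)
    x*[δ*y]≡δ*[x*y] a b c = trans (sym (*-assoc a b c)) (trans (cong (_* c) (*-comm a b)) (*-assoc b a c))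

  ⟪⟫-Σδ : ∀ {m} (j : Fin m → Fin nE) (y : Fin m → ℤ) l →
          ⟪ l , (λ e → Σℤ (λ d → [ j d ≟ᶠ e ]ℤ * y d)) ⟫ ≡ Σℤ (λ d → ℤ.+ len (j d) * (l (j d) * y d))
  ⟪⟫-Σδ j y l = begin
    Σℤ (λ e → ℤ.+ len e * (l e * Σℤ (λ d → [ j d ≟ᶠ e ]ℤ * y d)))
      ≡⟨ Σℤ-cong (λ e → trans (cong (ℤ.+ len e *_) (sym (Σℤ-*ˡ (l e) (λ d → [ j d ≟ᶠ e ]ℤ * y d))))
                              (sym (Σℤ-*ˡ (ℤ.+ len e) (λ d → l e * ([ j d ≟ᶠ e ]ℤ * y d))))) ⟩
    Σℤ (λ e → Σℤ (λ d → ℤ.+ len e * (l e * ([ j d ≟ᶠ e ]ℤ * y d))))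
      ≡⟨ Σℤ-comm (λ e d → ℤ.+ len e * (l e * ([ j d ≟ᶠ e ]ℤ * y d))) ⟩
    Σℤ (λ d → Σℤ (λ e → ℤ.+ len e * (l e * ([ j d ≟ᶠ e ]ℤ * y d))))
      ≡⟨ Σℤ-cong (λ d → trans (Σℤ-cong (λ e → solve 4 (λ a b c u → a :* (b :* (c :* u)) := c :* (a :* (b :* u))) refl
                                                      (ℤ.+ len e) (l e) [ j d ≟ᶠ e ]ℤ (y d)))
                             (Σℤ-δ (j d) (λ e → ℤ.+ len e * (l e * y d)))) ⟩
    Σℤ (λ d → ℤ.+ len (j d) * (l (j d) * y d))
      ∎
    where
    open ≡-Reasoning
    open +-*-Solver

  ∂-σ⁻¹ : ∀ y v → SV v ≡ false → ∂ (σ⁻¹ y) v ≡ sgnℤ (ε (inj₁ v)) * ∂ y (FV v)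
  ∂-σ⁻¹ y v v∉S = begin
    Σℤ (λ e → inc e v * σ⁻¹ y e)          ≡⟨ Σℤ-cong term ⟩
    Σℤ (λ e → s * h (FE e))               ≡⟨ Σℤ-*ˡ s (λ e → h (FE e)) ⟩
    s * Σℤ (λ e → h (FE e))               ≡⟨ cong (s *_) (Σℤ-FE h) ⟨
    s * ∂ y (FV v)                        ∎
    where
    open ≡-Reasoning
    open +-*-Solver
    s = sgnℤ (ε (inj₁ v))
    h : Fin nE → ℤ
    h e = inc e (FV v) * y e
    term : ∀ e → inc e v * σ⁻¹ y e ≡ s * h (FE e)
    term e with incident-or-inc≡0 e v
    ... | inj₁ e∋v = begin
      inc e v * (sgnℤ (ε (inj₂ e)) * (orient e * y (FE e)))
        ≡⟨ cong (λ t → inc e v * (sgnℤ t * (orient e * y (FE e)))) (ε-const e v (incident-outside e v v∉S e∋v) v∉S e∋v) ⟩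
      inc e v * (s * (orient e * y (FE e)))
        ≡⟨ solve 4 (λ a s o w → a :* (s :* (o :* w)) := s :* ((o :* a) :* w)) refl (inc e v) s (orient e) (y (FE e)) ⟩
      s * ((orient e * inc e v) * y (FE e))
        ≡⟨ cong (λ z → s * (z * y (FE e))) (orient*inc≡inc-F e v) ⟩
      s * h (FE e) ∎
    ... | inj₂ inc≡0 = begin
      inc e v * σ⁻¹ y e                   ≡⟨ cong (_* σ⁻¹ y e) inc≡0 ⟩
      0ℤ                                  ≡⟨ solve 2 (λ s w → con 0ℤ := s :* (con 0ℤ :* w)) refl s (y (FE e)) ⟩
      s * (0ℤ * y (FE e))                 ≡⟨ cong (λ z → s * (z * y (FE e))) (trans (sym (*-zeroʳ (orient e)))
                                                (trans (cong (orient e *_) (sym inc≡0)) (orient*inc≡inc-F e v))) ⟩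
      s * h (FE e)                        ∎

  σ⁻¹-InΛ : ∀ {y} → InΛ y → InΛ (σ⁻¹ y)
  σ⁻¹-InΛ {y} (y∈S⇒0 , ∂y≡0) =
    (λ e e∈S → trans (cong (λ z → sgnℤ (ε (inj₂ e)) * (orient e * z)) (y∈S⇒0 (FE e) (trans (F-SE e) e∈S)))
                     (trans (cong (sgnℤ (ε (inj₂ e)) *_) (*-zeroʳ (orient e))) (*-zeroʳ (sgnℤ (ε (inj₂ e)))))) ,
    (λ v v∉S → trans (∂-σ⁻¹ y v v∉S)
                     (trans (cong (sgnℤ (ε (inj₁ v)) *_) (∂y≡0 (FV v) (trans (F-SV v) v∉S))) (*-zeroʳ (sgnℤ (ε (inj₁ v))))))

  σ⁻¹-InΛ⁻¹ : ∀ {y} → InΛ (σ⁻¹ y) → InΛ y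
  σ⁻¹-InΛ⁻¹ {y} (σy∈S⇒0 , ∂σy≡0) = y∈S⇒0 , ∂y≡0
    where
    y∈S⇒0 : ∀ e → SE e ≡ true → y e ≡ 0ℤ
    y∈S⇒0 e e∈S = subst (λ w → y w ≡ 0ℤ) (FE-inv₁ e)
      (unit*z≡0⇒z≡0 (orient e') (y (FE e')) (orient*orient≡1 e')
        (unit*z≡0⇒z≡0 (sgnℤ (ε (inj₂ e'))) (orient e' * y (FE e')) (sgnℤ*sgnℤ≡1 (ε (inj₂ e')))
          (σy∈S⇒0 e' (trans (sym (F-SE e')) (trans (cong SE (FE-inv₁ e)) e∈S)))))
      where e' = FE⁻ e
    ∂y≡0 : ∀ v → SV v ≡ false → ∂ y v ≡ 0ℤ
    ∂y≡0 v v∉S = subst (λ w → ∂ y w ≡ 0ℤ) (FV-inv₁ v)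
      (unit*z≡0⇒z≡0 (sgnℤ (ε (inj₁ v'))) (∂ y (FV v')) (sgnℤ*sgnℤ≡1 (ε (inj₁ v')))
        (trans (sym (∂-σ⁻¹ y v' v'∉S)) (∂σy≡0 v' v'∉S)))
      where
      v' = FV⁻ v
      v'∉S : SV v' ≡ false
      v'∉S = trans (sym (F-SV v')) (trans (cong SV (FV-inv₁ v)) v∉S)

Σℕ-≥ : ∀ {n} (f : Fin n → ℕ) (a : Fin n) → f a ℕ.≤ Σℕ f
Σℕ-≥ f zero    = ℕₚ.m≤m+n (f zero) _
Σℕ-≥ f (suc a) = ℕₚ.≤-trans (Σℕ-≥ (λ i → f (suc i)) a) (ℕₚ.m≤n+m _ (f zero))

incident⇒1≤deg : ∀ G {e v} → Incident G e v → 1 ℕ.≤ deg G v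
incident⇒1≤deg G {e} {v} e∋v = ℕₚ.≤-trans (one≤ends e∋v) (Σℕ-≥ (λ d → [ Graph.src G d ≟ᶠ v ]ℕ ℕ.+ [ Graph.tgt G d ≟ᶠ v ]ℕ) e)
  where
  δℕ≥1 : ∀ {a} → a ≡ v → 1 ℕ.≤ [ a ≟ᶠ v ]ℕ
  δℕ≥1 {a} a≡v with a ≟ v
  ... | yes _   = ℕₚ.≤-refl
  ... | no a≢v = ⊥-elim (a≢v a≡v)
  one≤ends : Incident G e v → 1 ℕ.≤ [ Graph.src G e ≟ᶠ v ]ℕ ℕ.+ [ Graph.tgt G e ≟ᶠ v ]ℕ
  one≤ends (inj₁ src≡v) = ℕₚ.≤-trans (δℕ≥1 src≡v) (ℕₚ.m≤m+n _ _)
  one≤ends (inj₂ tgt≡v) = ℕₚ.≤-trans (δℕ≥1 tgt≡v) (ℕₚ.m≤n+m _ _)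

module GraphMap (A B : BYForest)
  (jV : Fin (BYForest.nV A) → Fin (BYForest.nV B))
  (jE : Fin (BYForest.nE A) → Fin (BYForest.nE B))
  (j-src : ∀ d → jV (BYForest.src A d) ≡ BYForest.src B (jE d))
  (j-tgt : ∀ d → jV (BYForest.tgt A d) ≡ BYForest.tgt B (jE d))
  (j-len : ∀ d → BYForest.len A d ≡ BYForest.len B (jE d))
  where
  private
    module A = BYForest A
    module B = BYForest B

  map-Joins : ∀ {d a b} → Joins A.graph d a b → Joins B.graph (jE d) (jV a) (jV b)
  map-Joins {d} (inj₁ (p , q)) = inj₁ (trans (sym (j-src d)) (cong jV p) , trans (sym (j-tgt d)) (cong jV q))
  map-Joins {d} (inj₂ (p , q)) = inj₂ (trans (sym (j-src d)) (cong jV p) , trans (sym (j-tgt d)) (cong jV q))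

  map-Incident : ∀ {d a} → Incident A.graph d a → Incident B.graph (jE d) (jV a)
  map-Incident {d} (inj₁ p) = inj₁ (trans (sym (j-src d)) (cong jV p))
  map-Incident {d} (inj₂ p) = inj₂ (trans (sym (j-tgt d)) (cong jV p))

  map-Walk : ∀ {u v n} (w : Walk A.graph A.len u v n) →
             Σ (Walk B.graph B.len (jV u) (jV v) n) (λ w' → walkVerts B.graph w' ≡ List.map jV (walkVerts A.graph w))
  map-Walk nil = nil , refl
  map-Walk {u} (cons {n = n} d d∋uw w) with map-Walk w
  ... | w' , verts≡ rewrite j-len d = cons (jE d) (map-Joins d∋uw) w' , cong (jV u ∷_) verts≡

  map-Path : ∀ {u v n} (P : Path A.graph A.len u v n) →
             Unique (List.map jV (walkVerts A.graph (proj₁ P))) → Path B.graph B.len (jV u) (jV v) n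
  map-Path (w , _) unique with map-Walk w
  ... | w' , verts≡ = w' , subst Unique (sym verts≡) unique

  map-Path-injective : Injective _≡_ _≡_ jV → ∀ {u v n} → Path A.graph A.len u v n → Path B.graph B.len (jV u) (jV v) n
  map-Path-injective jV-inj P = map-Path P (Uniqueₚ.map⁺ jV-inj (proj₂ P))

  ParityA-pullback : (∀ {u v n} → Path A.graph A.len u v n → Path B.graph B.len (jV u) (jV v) n) →
                     (∀ w → Special B (jV w) → Special A w) → ParityA B → ParityA A
  ParityA-pullback map-path special-pullback parityA u v n P odd with parityA (jV u) (jV v) n (map-path P) odd
  ... | inj₁ u-special = inj₁ (special-pullback u u-special)
  ... | inj₂ v-special = inj₂ (special-pullback v v-special)

  private
    ends-at : (G : Graph) → Fin (Graph.nV G) → Fin (Graph.nE G) → ℕ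
    ends-at G v e = [ Graph.src G e ≟ᶠ v ]ℕ ℕ.+ [ Graph.tgt G e ≟ᶠ v ]ℕ

    δℕ-map-≤ : ∀ a w → [ a ≟ᶠ w ]ℕ ℕ.≤ [ jV a ≟ᶠ jV w ]ℕ
    δℕ-map-≤ a w with a ≟ w | jV a ≟ jV w
    ... | yes _   | yes _     = ℕₚ.≤-refl
    ... | yes a≡w | no ja≢jw = ⊥-elim (ja≢jw (cong jV a≡w))
    ... | no _    | _         = ℕ.z≤n

    δℕ-map-≡ : ∀ {w} → (∀ a → jV a ≡ jV w → a ≡ w) → ∀ a → [ jV a ≟ᶠ jV w ]ℕ ≡ [ a ≟ᶠ w ]ℕ
    δℕ-map-≡ {w} inj-at-w a with jV a ≟ jV w | a ≟ w
    ... | yes _     | yes _   = refl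
    ... | no _      | no _    = refl
    ... | yes ja≡jw | no a≢w = ⊥-elim (a≢w (inj-at-w a ja≡jw))
    ... | no ja≢jw  | yes a≡w = ⊥-elim (ja≢jw (cong jV a≡w))

    ends-at-map : ∀ w d → ends-at B.graph (jV w) (jE d) ≡ [ jV (A.src d) ≟ᶠ jV w ]ℕ ℕ.+ [ jV (A.tgt d) ≟ᶠ jV w ]ℕ
    ends-at-map w d = cong₂ (λ a b → [ a ≟ᶠ jV w ]ℕ ℕ.+ [ b ≟ᶠ jV w ]ℕ) (sym (j-src d)) (sym (j-tgt d))

  deg-≤ : Injective _≡_ _≡_ jE → ∀ w → deg A.graph w ℕ.≤ deg B.graph (jV w)
  deg-≤ jE-inj w = drop‿+≤+ (begin
    ℤ.+ deg A.graph w                              ≡⟨ +Σℕ≡Σℤ+ (ends-at A.graph w) ⟩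
    Σℤ (λ d → ℤ.+ ends-at A.graph w d)             ≤⟨ Σℤ-mono-≤ (λ d → ℤ.+≤+ (subst (ends-at A.graph w d ℕ.≤_) (sym (ends-at-map w d))
                                                        (ℕₚ.+-mono-≤ (δℕ-map-≤ (A.src d) w) (δℕ-map-≤ (A.tgt d) w)))) ⟩
    Σℤ (λ d → ℤ.+ ends-at B.graph (jV w) (jE d))   ≤⟨ Σℤ-injective-≤ jE jE-inj (λ e → ℤ.+ ends-at B.graph (jV w) e) (λ _ → ℤ.+≤+ ℕ.z≤n) ⟩
    Σℤ (λ e → ℤ.+ ends-at B.graph (jV w) e)        ≡⟨ +Σℕ≡Σℤ+ (ends-at B.graph (jV w)) ⟨
    ℤ.+ deg B.graph (jV w)                         ∎)
    where open ≤-Reasoning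

  deg-≡ : Injective _≡_ _≡_ jE → ∀ w → (∀ a → jV a ≡ jV w → a ≡ w) →
          (∀ e → Incident B.graph e (jV w) → Σ (Fin A.nE) (λ d → jE d ≡ e)) →
          deg B.graph (jV w) ≡ deg A.graph w
  deg-≡ jE-inj w inj-at-w incident⇒image = +-injective (begin
    ℤ.+ deg B.graph (jV w)                         ≡⟨ +Σℕ≡Σℤ+ (ends-at B.graph (jV w)) ⟩
    Σℤ (λ e → ℤ.+ ends-at B.graph (jV w) e)        ≡⟨ Σℤ-reindex jE jE-inj (λ e → ℤ.+ ends-at B.graph (jV w) e) supp ⟩
    Σℤ (λ d → ℤ.+ ends-at B.graph (jV w) (jE d))   ≡⟨ Σℤ-cong (λ d → cong ℤ.+_ (trans (ends-at-map w d)
                                                        (cong₂ ℕ._+_ (δℕ-map-≡ inj-at-w (A.src d)) (δℕ-map-≡ inj-at-w (A.tgt d))))) ⟩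
    Σℤ (λ d → ℤ.+ ends-at A.graph w d)             ≡⟨ +Σℕ≡Σℤ+ (ends-at A.graph w) ⟨
    ℤ.+ deg A.graph w                              ∎)
    where
    open ≡-Reasoning
    supp : ∀ e → ℤ.+ ends-at B.graph (jV w) e ≢ 0ℤ → Σ (Fin A.nE) (λ d → jE d ≡ e)
    supp e ≢0 with B.src e ≟ jV w | B.tgt e ≟ jV w
    ... | yes p | _     = incident⇒image e (inj₁ p)
    ... | no _  | yes q = incident⇒image e (inj₂ q)
    ... | no _  | no _  = ⊥-elim (≢0 refl)

iter-commute : ∀ {X Y : Set} (f : X → X) (g : Y → Y) (h : X → Y) → (∀ x → h (f x) ≡ g (h x)) →
               ∀ n x → h (iter f n x) ≡ iter g n (h x)
iter-commute f g h h∘f≡g∘h zero    x = refl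
iter-commute f g h h∘f≡g∘h (suc n) x = trans (h∘f≡g∘h (iter f n x)) (cong g (iter-commute f g h h∘f≡g∘h n x))

iter-suc : ∀ {X : Set} (f : X → X) n x → iter f n (f x) ≡ f (iter f n x)
iter-suc f n x = sym (iter-commute f f f (λ _ → refl) n x)

iter-+ : ∀ {X : Set} (f : X → X) m n x → iter f (m ℕ.+ n) x ≡ iter f m (iter f n x)
iter-+ f zero    n x = refl
iter-+ f (suc m) n x = cong f (iter-+ f m n x)

Πˢ-cong : ∀ {n} {f g : Fin n → Sign} → (∀ i → f i ≡ g i) → Πˢ f ≡ Πˢ g
Πˢ-cong {zero}  f≗g = refl
Πˢ-cong {suc n} f≗g = cong₂ Data.Sign._*_ (f≗g zero) (Πˢ-cong (λ i → f≗g (suc i)))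

module Iterates (T : BYForest) where
  open BYForest T
  open Chains T

  σ-sign : Fin nE → ℤ
  σ-sign e = sgnℤ (ε (inj₂ e)) * orient e

  σ-sign*σ-sign≡1 : ∀ e → σ-sign e * σ-sign e ≡ 1ℤ
  σ-sign*σ-sign≡1 e = trans (solve 2 (λ a b → (a :* b) :* (a :* b) := (a :* a) :* (b :* b)) refl (sgnℤ (ε (inj₂ e))) (orient e))
                            (cong₂ _*_ (sgnℤ*sgnℤ≡1 (ε (inj₂ e))) (orient*orient≡1 e))
    where open +-*-Solver

  εⁿ : ℕ → Fin nE → ℤ
  εⁿ zero    e = 1ℤ
  εⁿ (suc n) e = sgnℤ (ε (inj₂ e)) * εⁿ n (FE e)

  orientⁿ : ℕ → Fin nE → ℤ
  orientⁿ zero    e = 1ℤ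
  orientⁿ (suc n) e = orient e * orientⁿ n (FE e)

  σ-signⁿ : ℕ → Fin nE → ℤ
  σ-signⁿ zero    e = 1ℤ
  σ-signⁿ (suc n) e = σ-sign e * σ-signⁿ n (FE e)

  σ-signⁿ≡εⁿ*orientⁿ : ∀ n e → σ-signⁿ n e ≡ εⁿ n e * orientⁿ n e
  σ-signⁿ≡εⁿ*orientⁿ zero    e = refl
  σ-signⁿ≡εⁿ*orientⁿ (suc n) e = trans (cong (σ-sign e *_) (σ-signⁿ≡εⁿ*orientⁿ n (FE e)))
    (solve 4 (λ a b x y → (a :* b) :* (x :* y) := (a :* x) :* (b :* y)) refl
       (sgnℤ (ε (inj₂ e))) (orient e) (εⁿ n (FE e)) (orientⁿ n (FE e)))
    where open +-*-Solver

  σ-signⁿ*σ-signⁿ≡1 : ∀ n e → σ-signⁿ n e * σ-signⁿ n e ≡ 1ℤ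
  σ-signⁿ*σ-signⁿ≡1 zero    e = refl
  σ-signⁿ*σ-signⁿ≡1 (suc n) e =
    trans (solve 2 (λ a b → (a :* b) :* (a :* b) := (a :* a) :* (b :* b)) refl (σ-sign e) (σ-signⁿ n (FE e)))
          (cong₂ _*_ (σ-sign*σ-sign≡1 e) (σ-signⁿ*σ-signⁿ≡1 n (FE e)))
    where open +-*-Solver

  σ-signⁿ-suc : ∀ n e → σ-signⁿ (suc n) e ≡ σ-signⁿ n e * σ-sign (iter FE n e)
  σ-signⁿ-suc zero    e = trans (*-identityʳ (σ-sign e)) (sym (*-identityˡ (σ-sign e)))
  σ-signⁿ-suc (suc n) e = begin
    σ-sign e * σ-signⁿ (suc n) (FE e)                           ≡⟨ cong (σ-sign e *_) (σ-signⁿ-suc n (FE e)) ⟩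
    σ-sign e * (σ-signⁿ n (FE e) * σ-sign (iter FE n (FE e)))   ≡⟨ *-assoc (σ-sign e) (σ-signⁿ n (FE e)) _ ⟨
    σ-signⁿ (suc n) e * σ-sign (iter FE n (FE e))               ≡⟨ cong (λ z → σ-signⁿ (suc n) e * σ-sign z) (iter-suc FE n e) ⟩
    σ-signⁿ (suc n) e * σ-sign (iter FE (suc n) e)              ∎
    where open ≡-Reasoning

  iter-σ⁻¹ : ∀ n y e → iter σ⁻¹ n y e ≡ σ-signⁿ n e * y (iter FE n e)
  iter-σ⁻¹ zero    y e = sym (*-identityˡ (y e))
  iter-σ⁻¹ (suc n) y e = begin
    sgnℤ (ε (inj₂ e)) * (orient e * iter σ⁻¹ n y (FE e))
      ≡⟨ cong (λ z → sgnℤ (ε (inj₂ e)) * (orient e * z)) (iter-σ⁻¹ n y (FE e)) ⟩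
    sgnℤ (ε (inj₂ e)) * (orient e * (σ-signⁿ n (FE e) * y (iter FE n (FE e))))
      ≡⟨ solve 4 (λ a b x w → a :* (b :* (x :* w)) := ((a :* b) :* x) :* w) refl
           (sgnℤ (ε (inj₂ e))) (orient e) (σ-signⁿ n (FE e)) (y (iter FE n (FE e))) ⟩
    σ-signⁿ (suc n) e * y (iter FE n (FE e))
      ≡⟨ cong (λ z → σ-signⁿ (suc n) e * y z) (iter-suc FE n e) ⟩
    σ-signⁿ (suc n) e * y (iter FE (suc n) e) ∎
    where
    open ≡-Reasoning
    open +-*-Solver

  iter-σ⁻¹-InΛ : ∀ n {y} → InΛ y → InΛ (iter σ⁻¹ n y)
  iter-σ⁻¹-InΛ zero    y∈Λ = y∈Λ
  iter-σ⁻¹-InΛ (suc n) y∈Λ = σ⁻¹-InΛ (iter-σ⁻¹-InΛ n y∈Λ)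

  len-iter-FE : ∀ n e → len (iter FE n e) ≡ len e
  len-iter-FE zero    e = refl
  len-iter-FE (suc n) e = trans (F-len (iter FE n e)) (len-iter-FE n e)

  IterOrientation : ℕ → Fin nE → Set
  IterOrientation n e =
      (orientⁿ n e ≡ 1ℤ  × iter FV n (src e) ≡ src (iter FE n e) × iter FV n (tgt e) ≡ tgt (iter FE n e))
    ⊎ (orientⁿ n e ≡ -1ℤ × iter FV n (src e) ≡ tgt (iter FE n e) × iter FV n (tgt e) ≡ src (iter FE n e))

  iterOrientation : ∀ n e → IterOrientation n e
  iterOrientation zero    e = inj₁ (refl , refl , refl)
  iterOrientation (suc n) e = compose (orientation e) (iterOrientation n (FE e))
    where
    step : ∀ {x y z} → FV x ≡ y → iter FV n y ≡ z → iter FV (suc n) x ≡ z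
    step {x} p q = trans (sym (iter-suc FV n x)) (trans (cong (iter FV n) p) q)
    Fⁿ⁺¹e≡ = iter-suc FE n e
    compose : Orientation e → IterOrientation n (FE e) → IterOrientation (suc n) e
    compose (inj₁ (o , s , t)) (inj₁ (o' , s' , t')) =
      inj₁ (cong₂ _*_ o o' , trans (step s s') (cong src Fⁿ⁺¹e≡) , trans (step t t') (cong tgt Fⁿ⁺¹e≡))
    compose (inj₁ (o , s , t)) (inj₂ (o' , s' , t')) =
      inj₂ (cong₂ _*_ o o' , trans (step s s') (cong tgt Fⁿ⁺¹e≡) , trans (step t t') (cong src Fⁿ⁺¹e≡))
    compose (inj₂ (o , s , t)) (inj₁ (o' , s' , t')) =
      inj₂ (cong₂ _*_ o o' , trans (step s t') (cong tgt Fⁿ⁺¹e≡) , trans (step t s') (cong src Fⁿ⁺¹e≡))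
    compose (inj₂ (o , s , t)) (inj₂ (o' , s' , t')) =
      inj₁ (cong₂ _*_ o o' , trans (step s t') (cong src Fⁿ⁺¹e≡) , trans (step t s') (cong tgt Fⁿ⁺¹e≡))

  iter-FE-Incident : ∀ n a v → Incident graph (iter FE n a) v →
                     Σ (Fin nV) (λ x → Incident graph a x × iter FV n x ≡ v)
  iter-FE-Incident n a v Fⁿa∋v with iterOrientation n a | Fⁿa∋v
  ... | inj₁ (_ , s , _) | inj₁ r = src a , inj₁ refl , trans s r
  ... | inj₁ (_ , _ , t) | inj₂ r = tgt a , inj₂ refl , trans t r
  ... | inj₂ (_ , _ , t) | inj₁ r = tgt a , inj₂ refl , trans t r
  ... | inj₂ (_ , s , _) | inj₂ r = src a , inj₁ refl , trans s r

  εⁿ≡Πˢ : ∀ n e → sgnℤ (Πˢ {n} (λ i → ε (iter Fpt (toℕ i) (inj₂ e)))) ≡ εⁿ n e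
  εⁿ≡Πˢ zero    e = refl
  εⁿ≡Πˢ (suc n) e = trans (sgnℤ-* (ε (inj₂ e)) _)
    (cong (sgnℤ (ε (inj₂ e)) *_)
      (trans (cong sgnℤ (Πˢ-cong {n} (λ i → cong ε (Fpt-iter-suc (toℕ i))))) (εⁿ≡Πˢ n (FE e))))
    where
    Fpt-iter : ∀ m a → iter Fpt m (inj₂ a) ≡ inj₂ (iter FE m a)
    Fpt-iter m a = sym (iter-commute FE Fpt inj₂ (λ _ → refl) m a)
    Fpt-iter-suc : ∀ m → Fpt (iter Fpt m (inj₂ e)) ≡ iter Fpt m (inj₂ (FE e))
    Fpt-iter-suc m = trans (cong Fpt (Fpt-iter m e)) (trans (cong inj₂ (sym (iter-suc FE m e))) (sym (Fpt-iter m (FE e))))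

module Embedding (A B : BYForest)
  (jV : Fin (BYForest.nV A) → Fin (BYForest.nV B))
  (jE : Fin (BYForest.nE A) → Fin (BYForest.nE B))
  (j-src : ∀ d → jV (BYForest.src A d) ≡ BYForest.src B (jE d))
  (j-tgt : ∀ d → jV (BYForest.tgt A d) ≡ BYForest.tgt B (jE d))
  (j-len : ∀ d → BYForest.len A d ≡ BYForest.len B (jE d))
  (j-SV : ∀ v → BYForest.SV A v ≡ BYForest.SV B (jV v))
  (j-SE : ∀ d → BYForest.SE A d ≡ BYForest.SE B (jE d))
  (jE-injective : Injective _≡_ _≡_ jE)
  -- only outside S: in (1) a vertex of S has one copy for each adjacent component of T ∖ S
  (jV-injective-outside : ∀ w a → BYForest.SV A w ≡ false → jV a ≡ jV w → a ≡ w)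
  (k' : ℕ)
  (j-FV : ∀ v → jV (BYForest.FV A v) ≡ iter (BYForest.FV B) (suc k') (jV v))
  (j-FE : ∀ d → jE (BYForest.FE A d) ≡ iter (BYForest.FE B) (suc k') (jE d))
  (j-ε : ∀ d → BYForest.SE A d ≡ false →
         sgnℤ (BYForest.ε A (inj₂ d)) ≡ Iterates.εⁿ B (suc k') (jE d))
  where
  private
    module A = BYForest A
    module B = BYForest B
    module CA = Chains A
    module CB = Chains B
    module IA = Iterates A
  open Iterates B
  open GraphMap A B jV jE j-src j-tgt j-len public

  inc-map : ∀ d w → A.SV w ≡ false → CB.inc (jE d) (jV w) ≡ CA.inc d w
  inc-map d w w∉S = cong₂ (λ a b → a + - b)
    (trans (cong (λ z → [ z ≟ᶠ jV w ]ℤ) (sym (j-tgt d))) (δ-map (λ a → jV-injective-outside w a w∉S) (A.tgt d)))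
    (trans (cong (λ z → [ z ≟ᶠ jV w ]ℤ) (sym (j-src d))) (δ-map (λ a → jV-injective-outside w a w∉S) (A.src d)))

  -- extendⁿ n = (εF)ⁿ ∘ extendⁿ 0 and restrictⁿ n = restrictⁿ 0 ∘ (εF)⁻ⁿ, see σ⁻¹-extendⁿ-suc and iter-σ⁻¹
  extendⁿ : ℕ → A.Chain → B.Chain
  extendⁿ n x e = Σℤ (λ d → [ iter B.FE n (jE d) ≟ᶠ e ]ℤ * (σ-signⁿ n (jE d) * x d))

  restrictⁿ : ℕ → B.Chain → A.Chain
  restrictⁿ n y d = σ-signⁿ n (jE d) * y (iter B.FE n (jE d))

  extend⁰-InΛ : ∀ {x} → A.InΛ x → B.InΛ (extendⁿ 0 x)
  extend⁰-InΛ {x} (x∈S⇒0 , ∂x≡0) = ext∈S⇒0 , ∂ext≡0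
    where
    ext∈S⇒0 : ∀ e → B.SE e ≡ true → extendⁿ 0 x e ≡ 0ℤ
    ext∈S⇒0 e e∈S = Σℤ-zero (λ d → δ*-vanish (λ jd≡e →
      trans (cong (1ℤ *_) (x∈S⇒0 d (trans (j-SE d) (trans (cong B.SE jd≡e) e∈S)))) refl))
    ∂ext≡0 : ∀ v → B.SV v ≡ false → B.∂ (extendⁿ 0 x) v ≡ 0ℤ
    ∂ext≡0 v v∉S with any? (λ w → jV w ≟ v)
    ... | yes (w , refl) = begin
      B.∂ (extendⁿ 0 x) (jV w)                 ≡⟨ CB.∂-Σδ jE (λ d → 1ℤ * x d) (jV w) ⟩
      Σℤ (λ d → CB.inc (jE d) (jV w) * (1ℤ * x d)) ≡⟨ Σℤ-cong (λ d → cong₂ _*_ (inc-map d w w∉S) (*-identityˡ (x d))) ⟩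
      A.∂ x w                                  ≡⟨ ∂x≡0 w w∉S ⟩
      0ℤ                                       ∎
      where
      open ≡-Reasoning
      w∉S = trans (j-SV w) v∉S
    ... | no ∄w = trans (CB.∂-Σδ jE (λ d → 1ℤ * x d) v) (Σℤ-zero (λ d → trans (cong (_* (1ℤ * x d)) (inc≡0 d)) refl))
      where
      inc≡0 : ∀ d → CB.inc (jE d) v ≡ 0ℤ
      inc≡0 d = cong₂ (λ a b → a + - b) (δ-≢ (λ t≡v → ∄w (A.tgt d , trans (j-tgt d) t≡v)))
                                          (δ-≢ (λ s≡v → ∄w (A.src d , trans (j-src d) s≡v)))

  σ⁻¹-extendⁿ-suc : ∀ n x e → B.σ⁻¹ (extendⁿ (suc n) x) e ≡ extendⁿ n x e
  σ⁻¹-extendⁿ-suc n x e = begin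
    sgnℤ (B.ε (inj₂ e)) * (B.orient e * extendⁿ (suc n) x (B.FE e))
      ≡⟨ *-assoc (sgnℤ (B.ε (inj₂ e))) (B.orient e) _ ⟨
    σ-sign e * extendⁿ (suc n) x (B.FE e)
      ≡⟨ Σℤ-*ˡ (σ-sign e) (λ d → [ B.FE (iter B.FE n (jE d)) ≟ᶠ B.FE e ]ℤ * (σ-signⁿ (suc n) (jE d) * x d)) ⟨
    Σℤ (λ d → σ-sign e * ([ B.FE (iter B.FE n (jE d)) ≟ᶠ B.FE e ]ℤ * (σ-signⁿ (suc n) (jE d) * x d)))
      ≡⟨ Σℤ-cong term ⟩
    extendⁿ n x e ∎
    where
    open ≡-Reasoning
    open +-*-Solver
    term : ∀ d → σ-sign e * ([ B.FE (iter B.FE n (jE d)) ≟ᶠ B.FE e ]ℤ * (σ-signⁿ (suc n) (jE d) * x d))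
               ≡ [ iter B.FE n (jE d) ≟ᶠ e ]ℤ * (σ-signⁿ n (jE d) * x d)
    term d = begin
      σ-sign e * ([ B.FE (iter B.FE n (jE d)) ≟ᶠ B.FE e ]ℤ * (σ-signⁿ (suc n) (jE d) * x d))
        ≡⟨ cong (λ δ → σ-sign e * (δ * (σ-signⁿ (suc n) (jE d) * x d))) (δ-map (λ _ → CB.FE-injective) (iter B.FE n (jE d))) ⟩
      σ-sign e * ([ iter B.FE n (jE d) ≟ᶠ e ]ℤ * (σ-signⁿ (suc n) (jE d) * x d))
        ≡⟨ solve 3 (λ s δ u → s :* (δ :* u) := δ :* (s :* u)) refl (σ-sign e) [ iter B.FE n (jE d) ≟ᶠ e ]ℤ _ ⟩
      [ iter B.FE n (jE d) ≟ᶠ e ]ℤ * (σ-sign e * (σ-signⁿ (suc n) (jE d) * x d))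
        ≡⟨ δ*-cong (λ Fⁿjd≡e → begin
             σ-sign e * (σ-signⁿ (suc n) (jE d) * x d)
               ≡⟨ cong (λ z → σ-sign e * (z * x d)) (σ-signⁿ-suc n (jE d)) ⟩
             σ-sign e * ((σ-signⁿ n (jE d) * σ-sign (iter B.FE n (jE d))) * x d)
               ≡⟨ cong (λ z → σ-sign e * ((σ-signⁿ n (jE d) * σ-sign z) * x d)) Fⁿjd≡e ⟩
             σ-sign e * ((σ-signⁿ n (jE d) * σ-sign e) * x d)
               ≡⟨ solve 3 (λ s t u → s :* ((t :* s) :* u) := (s :* s) :* (t :* u)) refl (σ-sign e) (σ-signⁿ n (jE d)) (x d) ⟩
             (σ-sign e * σ-sign e) * (σ-signⁿ n (jE d) * x d)
               ≡⟨ cong (_* (σ-signⁿ n (jE d) * x d)) (σ-sign*σ-sign≡1 e) ⟩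
             1ℤ * (σ-signⁿ n (jE d) * x d)
               ≡⟨ *-identityˡ _ ⟩
             σ-signⁿ n (jE d) * x d ∎) ⟩
      [ iter B.FE n (jE d) ≟ᶠ e ]ℤ * (σ-signⁿ n (jE d) * x d) ∎

  extendⁿ-InΛ : ∀ n {x} → A.InΛ x → B.InΛ (extendⁿ n x)
  extendⁿ-InΛ zero    x∈Λ = extend⁰-InΛ x∈Λ
  extendⁿ-InΛ (suc n) {x} x∈Λ = CB.σ⁻¹-InΛ⁻¹ (CB.InΛ-cong (λ e → sym (σ⁻¹-extendⁿ-suc n x e)) (extendⁿ-InΛ n x∈Λ))

  restrict-InΛ : (∀ w e → A.SV w ≡ false → Incident B.graph e (jV w) → B.SE e ≡ false → Σ (Fin A.nE) (λ d → jE d ≡ e)) →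
                 ∀ {y} → B.InΛ y → A.InΛ (λ d → y (jE d))
  restrict-InΛ incident⇒image {y} (y∈S⇒0 , ∂y≡0) = (λ d d∈S → y∈S⇒0 (jE d) (trans (sym (j-SE d)) d∈S)) , ∂res≡0
    where
    ∂res≡0 : ∀ w → A.SV w ≡ false → A.∂ (λ d → y (jE d)) w ≡ 0ℤ
    ∂res≡0 w w∉S = begin
      Σℤ (λ d → CA.inc d w * y (jE d))  ≡⟨ Σℤ-cong (λ d → cong (_* y (jE d)) (sym (inc-map d w w∉S))) ⟩
      Σℤ (λ d → h (jE d))               ≡⟨ Σℤ-reindex jE jE-injective h supp ⟨
      B.∂ y (jV w)                      ≡⟨ ∂y≡0 (jV w) (trans (sym (j-SV w)) w∉S) ⟩
      0ℤ                                ∎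
      where
      open ≡-Reasoning
      h : Fin B.nE → ℤ
      h e = CB.inc e (jV w) * y e
      supp : ∀ e → h e ≢ 0ℤ → Σ (Fin A.nE) (λ d → jE d ≡ e)
      supp e h≢0 with CB.incident-or-inc≡0 e (jV w)
      ... | inj₂ inc≡0 = ⊥-elim (h≢0 (cong (_* y e) inc≡0))
      ... | inj₁ e∋jw  = incident⇒image w e w∉S e∋jw
                           (¬-not (λ e∈S → h≢0 (trans (cong (CB.inc e (jV w) *_) (y∈S⇒0 e e∈S)) (*-zeroʳ (CB.inc e (jV w))))))

  restrictⁿ-InΛ : (∀ w e → A.SV w ≡ false → Incident B.graph e (jV w) → B.SE e ≡ false → Σ (Fin A.nE) (λ d → jE d ≡ e)) →
                  ∀ n {y} → B.InΛ y → A.InΛ (restrictⁿ n y)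
  restrictⁿ-InΛ incident⇒image n {y} y∈Λ =
    CA.InΛ-cong (λ d → iter-σ⁻¹ n y (jE d)) (restrict-InΛ incident⇒image (iter-σ⁻¹-InΛ n y∈Λ))

  private
    jV-FV-src : ∀ d → jV (A.FV (A.src d)) ≡ iter B.FV (suc k') (B.src (jE d))
    jV-FV-src d = trans (j-FV (A.src d)) (cong (iter B.FV (suc k')) (j-src d))
    jV-src-FE : ∀ d → jV (A.src (A.FE d)) ≡ B.src (iter B.FE (suc k') (jE d))
    jV-src-FE d = trans (j-src (A.FE d)) (cong B.src (j-FE d))
    jV-tgt-FE : ∀ d → jV (A.tgt (A.FE d)) ≡ B.tgt (iter B.FE (suc k') (jE d))
    jV-tgt-FE d = trans (j-tgt (A.FE d)) (cong B.tgt (j-FE d))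

  orient≡orientⁿ : ∀ d → A.orient d ≡ orientⁿ (suc k') (jE d)
  orient≡orientⁿ d with CA.orientation d | iterOrientation (suc k') (jE d)
  ... | inj₁ (o , _) | inj₁ (o' , _) = trans o (sym o')
  ... | inj₂ (o , _) | inj₂ (o' , _) = trans o (sym o')
  ... | inj₁ (_ , s , _) | inj₂ (_ , s' , _) = ⊥-elim (CB.src≢tgt (iter B.FE (suc k') (jE d))
    (trans (sym (jV-src-FE d)) (trans (cong jV (sym s)) (trans (jV-FV-src d) s'))))
  ... | inj₂ (_ , s , _) | inj₁ (_ , s' , _) = ⊥-elim (CB.src≢tgt (iter B.FE (suc k') (jE d))
    (trans (sym s') (trans (sym (jV-FV-src d)) (trans (cong jV s) (jV-tgt-FE d)))))

  σ-sign≡σ-signⁿ : ∀ d → A.SE d ≡ false → IA.σ-sign d ≡ σ-signⁿ (suc k') (jE d)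
  σ-sign≡σ-signⁿ d d∉S =
    trans (cong₂ _*_ (j-ε d d∉S) (orient≡orientⁿ d)) (sym (σ-signⁿ≡εⁿ*orientⁿ (suc k') (jE d)))

  σ⁻¹-extend⁰ : ∀ {x} → A.InΛ x → ∀ e → B.σ⁻¹ (extendⁿ 0 x) e ≡ extendⁿ k' (A.σ⁻¹ x) e
  σ⁻¹-extend⁰ {x} (x∈S⇒0 , _) e = begin
    sgnℤ (B.ε (inj₂ e)) * (B.orient e * extendⁿ 0 x (B.FE e))
      ≡⟨ *-assoc (sgnℤ (B.ε (inj₂ e))) (B.orient e) _ ⟨
    σ-sign e * Σℤ (λ d → [ jE d ≟ᶠ B.FE e ]ℤ * (1ℤ * x d))
      ≡⟨ cong (σ-sign e *_) (CA.Σℤ-FE (λ d → [ jE d ≟ᶠ B.FE e ]ℤ * (1ℤ * x d))) ⟩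
    σ-sign e * Σℤ (λ d → [ jE (A.FE d) ≟ᶠ B.FE e ]ℤ * (1ℤ * x (A.FE d)))
      ≡⟨ Σℤ-*ˡ (σ-sign e) (λ d → [ jE (A.FE d) ≟ᶠ B.FE e ]ℤ * (1ℤ * x (A.FE d))) ⟨
    Σℤ (λ d → σ-sign e * ([ jE (A.FE d) ≟ᶠ B.FE e ]ℤ * (1ℤ * x (A.FE d))))
      ≡⟨ Σℤ-cong term ⟩
    extendⁿ k' (A.σ⁻¹ x) e ∎
    where
    open ≡-Reasoning
    open +-*-Solver
    same-term : ∀ d → iter B.FE k' (jE d) ≡ e →
                σ-sign e * x (A.FE d) ≡ σ-signⁿ k' (jE d) * A.σ⁻¹ x d
    same-term d Fᵏjd≡e with A.SE d in d∈S?
    ... | true  = begin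
      σ-sign e * x (A.FE d)                        ≡⟨ cong (σ-sign e *_) Fd-vanishes ⟩
      σ-sign e * 0ℤ                                ≡⟨ solve 4 (λ s t ε o → s :* con 0ℤ := t :* (ε :* (o :* con 0ℤ))) refl
                                                        (σ-sign e) (σ-signⁿ k' (jE d)) (sgnℤ (A.ε (inj₂ d))) (A.orient d) ⟩
      σ-signⁿ k' (jE d) * (sgnℤ (A.ε (inj₂ d)) * (A.orient d * 0ℤ)) ≡⟨ cong (λ z → σ-signⁿ k' (jE d) * (sgnℤ (A.ε (inj₂ d)) * (A.orient d * z))) Fd-vanishes ⟨
      σ-signⁿ k' (jE d) * A.σ⁻¹ x d                ∎
      where Fd-vanishes = x∈S⇒0 (A.FE d) (trans (A.F-SE d) d∈S?)
    ... | false = sym (begin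
      t * (sgnℤ (A.ε (inj₂ d)) * (A.orient d * X))  ≡⟨ cong (t *_) (*-assoc (sgnℤ (A.ε (inj₂ d))) (A.orient d) X) ⟨
      t * (IA.σ-sign d * X)                          ≡⟨ cong (λ z → t * (z * X)) (σ-sign≡σ-signⁿ d d∈S?) ⟩
      t * (σ-signⁿ (suc k') (jE d) * X)              ≡⟨ cong (λ z → t * (z * X)) (σ-signⁿ-suc k' (jE d)) ⟩
      t * ((t * σ-sign (iter B.FE k' (jE d))) * X)   ≡⟨ cong (λ z → t * ((t * σ-sign z) * X)) Fᵏjd≡e ⟩
      t * ((t * σ-sign e) * X)                       ≡⟨ solve 3 (λ t s X → t :* ((t :* s) :* X) := (t :* t) :* (s :* X)) refl t (σ-sign e) X ⟩
      (t * t) * (σ-sign e * X)                       ≡⟨ cong (_* (σ-sign e * X)) (σ-signⁿ*σ-signⁿ≡1 k' (jE d)) ⟩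
      1ℤ * (σ-sign e * X)                            ≡⟨ *-identityˡ _ ⟩
      σ-sign e * X                                   ∎)
      where
      t = σ-signⁿ k' (jE d)
      X = x (A.FE d)
    term : ∀ d → σ-sign e * ([ jE (A.FE d) ≟ᶠ B.FE e ]ℤ * (1ℤ * x (A.FE d)))
               ≡ [ iter B.FE k' (jE d) ≟ᶠ e ]ℤ * (σ-signⁿ k' (jE d) * A.σ⁻¹ x d)
    term d = begin
      σ-sign e * ([ jE (A.FE d) ≟ᶠ B.FE e ]ℤ * (1ℤ * x (A.FE d)))
        ≡⟨ cong (λ z → σ-sign e * ([ z ≟ᶠ B.FE e ]ℤ * (1ℤ * x (A.FE d)))) (j-FE d) ⟩
      σ-sign e * ([ B.FE (iter B.FE k' (jE d)) ≟ᶠ B.FE e ]ℤ * (1ℤ * x (A.FE d)))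
        ≡⟨ cong (λ δ → σ-sign e * (δ * (1ℤ * x (A.FE d)))) (δ-map (λ _ → CB.FE-injective) (iter B.FE k' (jE d))) ⟩
      σ-sign e * ([ iter B.FE k' (jE d) ≟ᶠ e ]ℤ * (1ℤ * x (A.FE d)))
        ≡⟨ solve 3 (λ s δ X → s :* (δ :* (con 1ℤ :* X)) := δ :* (s :* X)) refl (σ-sign e) [ iter B.FE k' (jE d) ≟ᶠ e ]ℤ (x (A.FE d)) ⟩
      [ iter B.FE k' (jE d) ≟ᶠ e ]ℤ * (σ-sign e * x (A.FE d))
        ≡⟨ δ*-cong (same-term d) ⟩
      [ iter B.FE k' (jE d) ≟ᶠ e ]ℤ * (σ-signⁿ k' (jE d) * A.σ⁻¹ x d) ∎

  Good-σ⁻¹-extend⁰ : ∀ {φ} → QMod.Good (Φ B) φ → ∀ x → A.InΛ x → φ (B.σ⁻¹ (extendⁿ 0 x)) ≡ φ (extendⁿ k' (A.σ⁻¹ x))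
  Good-σ⁻¹-extend⁰ (resp , _) x x∈Λ =
    resp _ _ (CB.σ⁻¹-InΛ (extend⁰-InΛ x∈Λ)) (extendⁿ-InΛ k' (CA.σ⁻¹-InΛ x∈Λ)) (σ⁻¹-extend⁰ x∈Λ)

  Good-σ⁻¹-extendⁿ-suc : ∀ {φ} → QMod.Good (Φ B) φ → ∀ n x → A.InΛ x → φ (B.σ⁻¹ (extendⁿ (suc n) x)) ≡ φ (extendⁿ n x)
  Good-σ⁻¹-extendⁿ-suc (resp , _) n x x∈Λ =
    resp _ _ (CB.σ⁻¹-InΛ (extendⁿ-InΛ (suc n) x∈Λ)) (extendⁿ-InΛ n x∈Λ) (σ⁻¹-extendⁿ-suc n x)

  jE-iter : ∀ m d → jE (iter A.FE m d) ≡ iter B.FE (m ℕ.* suc k') (jE d)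
  jE-iter zero    d = refl
  jE-iter (suc m) d = trans (j-FE (iter A.FE m d))
    (trans (cong (iter B.FE (suc k')) (jE-iter m d)) (sym (iter-+ B.FE (suc k') (m ℕ.* suc k') (jE d))))

  jV-iter : ∀ m v → jV (iter A.FV m v) ≡ iter B.FV (m ℕ.* suc k') (jV v)
  jV-iter zero    v = refl
  jV-iter (suc m) v = trans (j-FV (iter A.FV m v))
    (trans (cong (iter B.FV (suc k')) (jV-iter m v)) (sym (iter-+ B.FV (suc k') (m ℕ.* suc k') (jV v))))

  ParityB-pullback : ParityB B → ParityB A
  ParityB-pullback parityB n d (Fⁿd≡d , src↦tgt , tgt↦src) odd =
    parityB (k' ℕ.+ n ℕ.* suc k') (jE d)
      ( trans (sym (jE-iter (suc n) d)) (cong jE Fⁿd≡d)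
      , trans (cong (iter B.FV (suc n ℕ.* suc k')) (sym (j-src d)))
              (trans (sym (jV-iter (suc n) (A.src d))) (trans (cong jV src↦tgt) (j-tgt d)))
      , trans (cong (iter B.FV (suc n ℕ.* suc k')) (sym (j-tgt d)))
              (trans (sym (jV-iter (suc n) (A.tgt d))) (trans (cong jV tgt↦src) (j-src d))))
      (subst Odd (j-len d) odd)

  Special-pullback : Injective _≡_ _≡_ jV → (∀ w e → Incident B.graph e (jV w) → Σ (Fin A.nE) (λ d → jE d ≡ e)) →
                     ∀ w → Special B (jV w) → Special A w
  Special-pullback jV-inj incident⇒image w special = transfer special
    where
    deg≡ : deg B.graph (jV w) ≡ deg A.graph w
    deg≡ = deg-≡ jE-injective w (λ a p → jV-inj p) (incident⇒image w)
    edges-of : ∀ {b} → (∀ e → Incident B.graph e (jV w) → B.SE e ≡ b) → ∀ d → Incident A.graph d w → A.SE d ≡ b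
    edges-of all-b d d∋w = trans (j-SE d) (all-b (jE d) (map-Incident d∋w))
    transfer : Special B (jV w) → Special A w
    transfer (inj₁ (deg≡1 , w∈S , edges∉S)) =
      inj₁ (trans (sym deg≡) deg≡1 , trans (j-SV w) w∈S , edges-of edges∉S)
    transfer (inj₂ (inj₁ (deg≡2 , w∉S))) =
      inj₂ (inj₁ (trans (sym deg≡) deg≡2 , trans (j-SV w) w∉S))
    transfer (inj₂ (inj₂ (deg≡2 , w∈S , edges∈S))) =
      inj₂ (inj₂ (trans (sym deg≡) deg≡2 , trans (j-SV w) w∈S , edges-of edges∈S))

module Decomposition (T : BYForest) {k : ℕ} (Ts : Fin k → BYForest)
  (j : (i : Fin k) → Fin (BYForest.nE (Ts i)) → Fin (BYForest.nE T))
  (s : (i : Fin k) → Fin (BYForest.nE (Ts i)) → ℤ)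
  where
  private
    module T = BYForest T
    module Ts (i : Fin k) = BYForest (Ts i)
    module CT = Chains T
    module CTs (i : Fin k) = Chains (Ts i)

  push : (i : Fin k) → Ts.Chain i → T.Chain
  push i x e = Σℤ (λ d → [ j i d ≟ᶠ e ]ℤ * (s i d * x d))

  pull : (i : Fin k) → T.Chain → Ts.Chain i
  pull i x d = s i d * x (j i d)

  toPieces : (T.Chain → ℤ) → (i : Fin k) → Ts.Chain i → ℤ
  toPieces φ i x = φ (push i x)

  fromPieces : ((i : Fin k) → Ts.Chain i → ℤ) → T.Chain → ℤ
  fromPieces ψ x = Σℤ (λ i → ψ i (pull i x))

  -- For suitable act, ⨁ (λ i → Φ (Ts i)) and Ind q' (Φ T₀) are definitionally Pieces act.
  Pieces : (((i : Fin k) → Ts.Chain i → ℤ) → (i : Fin k) → Ts.Chain i → ℤ) → QMod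
  Pieces act = record
    { Car  = (i : Fin k) → Ts.Chain i → ℤ
    ; Good = λ ψ → ∀ i → QMod.Good (Φ (Ts i)) (ψ i)
    ; _~_  = λ ψ ψ' → ∀ i → QMod._~_ (Φ (Ts i)) (ψ i) (ψ' i)
    ; _⊕_  = λ ψ ψ' i x → ψ i x + ψ' i x
    ; 𝟘    = λ i x → 0ℤ
    ; act  = act
    }

  module Iso
    (s*s≡1 : ∀ i d → s i d * s i d ≡ 1ℤ)
    (j-disjoint : ∀ i i' d d' → j i d ≡ j i' d' → i ≡ i')
    (j-injective : ∀ i → Injective _≡_ _≡_ (j i))
    (j-cover : ∀ e → T.SE e ≡ false → Σ (Fin k) (λ i → Σ (Fin (Ts.nE i)) (λ d → j i d ≡ e)))
    (j-len : ∀ i d → Ts.len i d ≡ T.len (j i d))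
    (push-InΛ : ∀ i {x} → Ts.InΛ i x → T.InΛ (push i x))
    (pull-InΛ : ∀ i {x} → T.InΛ x → Ts.InΛ i (pull i x))
    where

    pull-push-same : ∀ i x d → pull i (push i x) d ≡ x d
    pull-push-same i x d = begin
      s i d * Σℤ (λ d' → [ j i d' ≟ᶠ j i d ]ℤ * (s i d' * x d'))
        ≡⟨ cong (s i d *_) (Σℤ-single d (λ d' d'≢d → δ*-vanish (λ jd'≡jd → ⊥-elim (d'≢d (j-injective i jd'≡jd))))) ⟩
      s i d * ([ j i d ≟ᶠ j i d ]ℤ * (s i d * x d)) ≡⟨ cong (λ δ → s i d * (δ * (s i d * x d))) (δ-≡ {a = j i d} refl) ⟩
      s i d * (1ℤ * (s i d * x d))                   ≡⟨ cong (s i d *_) (*-identityˡ (s i d * x d)) ⟩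
      s i d * (s i d * x d)                          ≡⟨ *-assoc (s i d) (s i d) (x d) ⟨
      (s i d * s i d) * x d                          ≡⟨ cong (_* x d) (s*s≡1 i d) ⟩
      1ℤ * x d                                       ≡⟨ *-identityˡ (x d) ⟩
      x d                                            ∎
      where open ≡-Reasoning

    pull-push-other : ∀ i i' x d' → i' ≢ i → pull i' (push i x) d' ≡ 0ℤ
    pull-push-other i i' x d' i'≢i = trans
      (cong (s i' d' *_) (Σℤ-zero (λ d → δ*-vanish (λ jd≡jd' → ⊥-elim (i'≢i (sym (j-disjoint i i' d d' jd≡jd')))))))
      (*-zeroʳ (s i' d'))

    multiplicity : Fin T.nE → ℤ
    multiplicity e = Σℤ (λ i → Σℤ (λ d → [ j i d ≟ᶠ e ]ℤ))

    multiplicity≡1 : ∀ e → T.SE e ≡ false → multiplicity e ≡ 1ℤ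
    multiplicity≡1 e e∉S with j-cover e e∉S
    ... | i₀ , d₀ , jd₀≡e = trans
      (Σℤ-single i₀ (λ i i≢i₀ → Σℤ-zero (λ d → δ-≢ (λ jd≡e → i≢i₀ (j-disjoint i i₀ d d₀ (trans jd≡e (sym jd₀≡e)))))))
      (trans (Σℤ-single d₀ (λ d d≢d₀ → δ-≢ (λ jd≡e → d≢d₀ (j-injective i₀ (trans jd≡e (sym jd₀≡e)))))) (δ-≡ jd₀≡e))

    Σ-push-pull : ∀ x → T.InΛ x → ∀ e → CT.ΣC (λ i → push i (pull i x)) e ≡ x e
    Σ-push-pull x x∈Λ e = begin
      Σℤ (λ i → Σℤ (λ d → [ j i d ≟ᶠ e ]ℤ * (s i d * (s i d * x (j i d)))))
        ≡⟨ Σℤ-cong (λ i → Σℤ-cong (λ d → δ*-cong (λ jd≡e → s*[s*x]≡x i d jd≡e))) ⟩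
      Σℤ (λ i → Σℤ (λ d → [ j i d ≟ᶠ e ]ℤ * x e))
        ≡⟨ Σℤ-cong (λ i → Σℤ-*ʳ (x e) (λ d → [ j i d ≟ᶠ e ]ℤ)) ⟩
      Σℤ (λ i → Σℤ (λ d → [ j i d ≟ᶠ e ]ℤ) * x e)
        ≡⟨ Σℤ-*ʳ (x e) (λ i → Σℤ (λ d → [ j i d ≟ᶠ e ]ℤ)) ⟩
      multiplicity e * x e
        ≡⟨ multiplicity*x≡x (T.SE e) refl ⟩
      x e ∎
      where
      open ≡-Reasoning
      s*[s*x]≡x : ∀ i d → j i d ≡ e → s i d * (s i d * x (j i d)) ≡ x e
      s*[s*x]≡x i d jd≡e = trans (sym (*-assoc (s i d) (s i d) _))
        (trans (cong (_* x (j i d)) (s*s≡1 i d)) (trans (*-identityˡ (x (j i d))) (cong x jd≡e)))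
      multiplicity*x≡x : ∀ b → T.SE e ≡ b → multiplicity e * x e ≡ x e
      multiplicity*x≡x true  e∈S = trans (cong (multiplicity e *_) (proj₁ x∈Λ e e∈S))
                                         (trans (*-zeroʳ (multiplicity e)) (sym (proj₁ x∈Λ e e∈S)))
      multiplicity*x≡x false e∉S = trans (cong (_* x e) (multiplicity≡1 e e∉S)) (*-identityˡ (x e))

    push-cong : ∀ i {x y} → (∀ d → x d ≡ y d) → ∀ e → push i x e ≡ push i y e
    push-cong i x≗y e = Σℤ-cong (λ d → cong (λ z → [ j i d ≟ᶠ e ]ℤ * (s i d * z)) (x≗y d))

    push-+ : ∀ i x y e → push i (Ts._+c_ i x y) e ≡ push i x e + push i y e
    push-+ i x y e = trans
      (Σℤ-cong (λ d → solve 4 (λ δ t u v → δ :* (t :* (u :+ v)) := δ :* (t :* u) :+ δ :* (t :* v)) refl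
                                [ j i d ≟ᶠ e ]ℤ (s i d) (x d) (y d)))
      (Σℤ-distrib-+ (λ d → [ j i d ≟ᶠ e ]ℤ * (s i d * x d)) (λ d → [ j i d ≟ᶠ e ]ℤ * (s i d * y d)))
      where open +-*-Solver

    ⟪l,push⟫≡⟪pull,x⟫ : ∀ i l x → T.⟪_,_⟫ l (push i x) ≡ Ts.⟪_,_⟫ i (pull i l) x
    ⟪l,push⟫≡⟪pull,x⟫ i l x = trans (CT.⟪⟫-Σδ (j i) (λ d → s i d * x d) l) (Σℤ-cong (λ d →
      cong₂ _*_ (cong ℤ.+_ (sym (j-len i d))) (solve 3 (λ l t u → l :* (t :* u) := (t :* l) :* u) refl (l (j i d)) (s i d) (x d))))
      where open +-*-Solver

    toPieces-Good : ∀ {φ} → QMod.Good (Φ T) φ → QMod.Good (Pieces (λ ψ → ψ)) (toPieces φ)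
    toPieces-Good (resp , additive) i =
      (λ x y x∈Λ y∈Λ x≗y → resp (push i x) (push i y) (push-InΛ i x∈Λ) (push-InΛ i y∈Λ) (push-cong i x≗y)) ,
      (λ x y x∈Λ y∈Λ → trans (resp (push i (Ts._+c_ i x y)) (T._+c_ (push i x) (push i y))
                                   (push-InΛ i (CTs.+c-InΛ i x∈Λ y∈Λ)) (CT.+c-InΛ (push-InΛ i x∈Λ) (push-InΛ i y∈Λ))
                                   (push-+ i x y))
                             (additive (push i x) (push i y) (push-InΛ i x∈Λ) (push-InΛ i y∈Λ)))

    fromPieces-Good : ∀ {ψ} → QMod.Good (Pieces (λ ψ → ψ)) ψ → QMod.Good (Φ T) (fromPieces ψ)
    fromPieces-Good {ψ} G =
      (λ x y x∈Λ y∈Λ x≗y → Σℤ-cong (λ i → proj₁ (G i) (pull i x) (pull i y) (pull-InΛ i x∈Λ) (pull-InΛ i y∈Λ)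
                                              (λ d → cong (s i d *_) (x≗y (j i d))))) ,
      (λ x y x∈Λ y∈Λ → trans (Σℤ-cong (λ i →
          trans (proj₁ (G i) (pull i (T._+c_ x y)) (Ts._+c_ i (pull i x) (pull i y))
                             (pull-InΛ i (CT.+c-InΛ x∈Λ y∈Λ)) (CTs.+c-InΛ i (pull-InΛ i x∈Λ) (pull-InΛ i y∈Λ))
                             (λ d → *-distribˡ-+ (s i d) (x (j i d)) (y (j i d))))
                (proj₂ (G i) (pull i x) (pull i y) (pull-InΛ i x∈Λ) (pull-InΛ i y∈Λ))))
        (Σℤ-distrib-+ (λ i → ψ i (pull i x)) (λ i → ψ i (pull i y))))

    toPieces-cong : ∀ {φ φ'} → QMod._~_ (Φ T) φ φ' → QMod._~_ (Pieces (λ ψ → ψ)) (toPieces φ) (toPieces φ')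
    toPieces-cong {φ} {φ'} (l , l∈Λ , φ≡φ'+⟪l⟫) i =
      pull i l , pull-InΛ i l∈Λ ,
      (λ x x∈Λ → trans (φ≡φ'+⟪l⟫ (push i x) (push-InΛ i x∈Λ)) (cong (φ' (push i x) +_) (⟪l,push⟫≡⟪pull,x⟫ i l x)))

    fromPieces-cong : ∀ {ψ ψ'} → QMod._~_ (Pieces (λ ψ → ψ)) ψ ψ' → QMod._~_ (Φ T) (fromPieces ψ) (fromPieces ψ')
    fromPieces-cong {ψ} {ψ'} ψ~ψ' = L , CT.ΣC-InΛ l (λ i → push-InΛ i (proj₁ (proj₂ (ψ~ψ' i)))) , λ x x∈Λ → begin
      Σℤ (λ i → ψ i (pull i x))
        ≡⟨ Σℤ-cong (λ i → proj₂ (proj₂ (ψ~ψ' i)) (pull i x) (pull-InΛ i x∈Λ)) ⟩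
      Σℤ (λ i → ψ' i (pull i x) + Ts.⟪_,_⟫ i (proj₁ (ψ~ψ' i)) (pull i x))
        ≡⟨ Σℤ-distrib-+ (λ i → ψ' i (pull i x)) (λ i → Ts.⟪_,_⟫ i (proj₁ (ψ~ψ' i)) (pull i x)) ⟩
      fromPieces ψ' x + Σℤ (λ i → Ts.⟪_,_⟫ i (proj₁ (ψ~ψ' i)) (pull i x))
        ≡⟨ cong (fromPieces ψ' x +_) (Σℤ-cong (λ i → begin
             Ts.⟪_,_⟫ i (proj₁ (ψ~ψ' i)) (pull i x) ≡⟨ CTs.⟪⟫-comm i (proj₁ (ψ~ψ' i)) (pull i x) ⟩
             Ts.⟪_,_⟫ i (pull i x) (proj₁ (ψ~ψ' i)) ≡⟨ ⟪l,push⟫≡⟪pull,x⟫ i x (proj₁ (ψ~ψ' i)) ⟨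
             T.⟪_,_⟫ x (l i)                       ≡⟨ CT.⟪⟫-comm x (l i) ⟩
             T.⟪_,_⟫ (l i) x                       ∎)) ⟩
      fromPieces ψ' x + Σℤ (λ i → T.⟪_,_⟫ (l i) x)
        ≡⟨ cong (fromPieces ψ' x +_) (CT.⟪ΣC,x⟫ l x) ⟨
      fromPieces ψ' x + T.⟪_,_⟫ L x ∎
      where
      open ≡-Reasoning
      l : Fin k → T.Chain
      l i = push i (proj₁ (ψ~ψ' i))
      L = CT.ΣC l

    fromPieces-toPieces : ∀ {φ} → QMod.Good (Φ T) φ → QMod._~_ (Φ T) (fromPieces (toPieces φ)) φ
    fromPieces-toPieces {φ} G = CT.~-of-≡ (λ x x∈Λ →
      trans (sym (CT.Good-ΣC G (λ i → push i (pull i x)) (λ i → push-InΛ i (pull-InΛ i x∈Λ))))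
            (proj₁ G _ x (CT.ΣC-InΛ _ (λ i → push-InΛ i (pull-InΛ i x∈Λ))) x∈Λ (Σ-push-pull x x∈Λ)))

    toPieces-fromPieces : ∀ {ψ} → QMod.Good (Pieces (λ ψ → ψ)) ψ → QMod._~_ (Pieces (λ ψ → ψ)) (toPieces (fromPieces ψ)) ψ
    toPieces-fromPieces {ψ} G i = CTs.~-of-≡ i (λ x x∈Λ →
      trans (Σℤ-single i (λ i' i'≢i → CTs.Good-zero i' (G i') (pull i' (push i x)) (pull-InΛ i' (push-InΛ i x∈Λ))
                                        (λ d → pull-push-other i i' x d i'≢i)))
            (proj₁ (G i) _ x (pull-InΛ i (push-InΛ i x∈Λ)) x∈Λ (pull-push-same i x)))

    ≅-Pieces : (act : ((i : Fin k) → Ts.Chain i → ℤ) → (i : Fin k) → Ts.Chain i → ℤ) →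
               (∀ {φ} → QMod.Good (Φ T) φ → QMod._~_ (Pieces act) (toPieces (QMod.act (Φ T) φ)) (act (toPieces φ))) →
               Φ T ≅ Pieces act
    ≅-Pieces act toPieces-act = record
      { f      = toPieces
      ; g      = fromPieces
      ; f-good = toPieces-Good
      ; g-good = fromPieces-Good
      ; f-cong = λ {φ} {φ'} _ _ → toPieces-cong {φ} {φ'}
      ; g-cong = λ {ψ} {ψ'} _ _ → fromPieces-cong {ψ} {ψ'}
      ; f-hom  = λ _ _ i → CTs.~-of-≡ i (λ _ _ → refl)
      ; gf     = fromPieces-toPieces
      ; fg     = toPieces-fromPieces
      ; f-act  = toPieces-act
      }

module OfDisjointUnion (T : BYForest) (k : ℕ) (Ts : Fin k → BYForest) (D : DisjointUnion T Ts) where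
  private
    module T = BYForest T
    module Ts (i : Fin k) = BYForest (Ts i)
    module ι (i : Fin k) = SubEmbedding (DisjointUnion.emb D i)
  open DisjointUnion D

  incident⇒image : ∀ i w e → Incident T.graph e (ι.ιV i w) → Σ (Fin (Ts.nE i)) (λ d → ι.ιE i d ≡ e)
  incident⇒image i w e e∋ιw with coverE e
  ... | i' , d' , ιd'≡e with endpoint-piece e∋ιw
    where
    endpoint-piece : Incident T.graph e (ι.ιV i w) → i' ≡ i
    endpoint-piece (inj₁ p) = disjV i' i (Ts.src i' d') w (trans (ι.ι-src i' d') (trans (cong T.src ιd'≡e) p))
    endpoint-piece (inj₂ p) = disjV i' i (Ts.tgt i' d') w (trans (ι.ι-tgt i' d') (trans (cong T.tgt ιd'≡e) p))
  ... | refl = d' , ιd'≡e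

  module Emb (i : Fin k) = Embedding (Ts i) T (ι.ιV i) (ι.ιE i) (ι.ι-src i) (ι.ι-tgt i) (ι.ι-len i) (ι.ι-SV i) (ι.ι-SE i)
    (ι.ιE-inj i) (λ w a _ ιa≡ιw → ι.ιV-inj i ιa≡ιw) 0 (ι.ι-FV i) (ι.ι-FE i)
    (λ d d∉S → trans (cong sgnℤ (ι.ι-εE i d d∉S)) (sym (*-identityʳ _)))

  open Decomposition T Ts ι.ιE (λ _ _ → 1ℤ)

  Φ≅⨁ : Φ T ≅ ⨁ (λ i → Φ (Ts i))
  Φ≅⨁ = Iso.≅-Pieces (λ _ _ → refl) disjE ι.ιE-inj (λ e _ → coverE e) ι.ι-len
    (λ i → Emb.extend⁰-InΛ i) (λ i → Emb.restrictⁿ-InΛ i (λ w e _ e∋ιw _ → incident⇒image i w e e∋ιw) 0)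
    (λ ψ i x → ψ i (Ts.σ⁻¹ i x))
    (λ G i → Chains.~-of-≡ (Ts i) (Emb.Good-σ⁻¹-extend⁰ i G))

  ParityA-pullback : ParityA T → ∀ i → ParityA (Ts i)
  ParityA-pullback parityA i = Emb.ParityA-pullback i (Emb.map-Path-injective i (ι.ιV-inj i))
    (Emb.Special-pullback i (ι.ιV-inj i) (incident⇒image i)) parityA

  ParityB-pullback : ParityB T → ∀ i → ParityB (Ts i)
  ParityB-pullback parityB i = Emb.ParityB-pullback i parityB

module OfClosureSplitting (T T₀ : BYForest) (C : ClosureSplitting T₀ T) where
  private
    module T  = BYForest T
    module T₀ = BYForest T₀
    module CT = Chains T
  open ClosureSplitting C

  private
    πV-injective-outside : ∀ w a → T₀.SV w ≡ false → πV a ≡ πV w → a ≡ w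
    πV-injective-outside w a w∉S πa≡πw = sym (πV-inj-out w a w∉S (sym πa≡πw))

  module Emb = Embedding T₀ T πV πE π-src π-tgt π-len π-SV π-SE πE-inj πV-injective-outside 0 π-FV π-FE
    (λ d d∉S → trans (cong sgnℤ (π-εE d d∉S)) (sym (*-identityʳ _)))

  open Decomposition T (λ (_ : Fin 1) → T₀) (λ _ → πE) (λ _ _ → 1ℤ)
  private
    single-piece : ∀ (i i' : Fin 1) (d d' : Fin T₀.nE) → πE d ≡ πE d' → i ≡ i'
    single-piece zero zero _ _ _ = refl

  open Iso (λ _ _ → refl) single-piece (λ _ → πE-inj) (λ e e∉S → zero , πE-surj e e∉S) (λ _ → π-len)
    (λ _ → Emb.extend⁰-InΛ) (λ _ → Emb.restrictⁿ-InΛ (λ _ e _ _ e∉S → πE-surj e e∉S) 0)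

  Φ≅Φ₀ : Φ T ≅ Φ T₀
  Φ≅Φ₀ = record
    { f      = λ φ → toPieces φ zero
    ; g      = λ ψ → fromPieces (λ _ → ψ)
    ; f-good = λ G → toPieces-Good G zero
    ; g-good = λ G → fromPieces-Good (λ _ → G)
    ; f-cong = λ {φ} {φ'} _ _ φ~φ' → toPieces-cong {φ} {φ'} φ~φ' zero
    ; g-cong = λ {ψ} {ψ'} _ _ ψ~ψ' → fromPieces-cong {λ _ → ψ} {λ _ → ψ'} (λ _ → ψ~ψ')
    ; f-hom  = λ _ _ → Chains.~-of-≡ T₀ (λ _ _ → refl)
    ; gf     = fromPieces-toPieces
    ; fg     = λ G → toPieces-fromPieces (λ _ → G) zero
    ; f-act  = λ G → Chains.~-of-≡ T₀ (Emb.Good-σ⁻¹-extend⁰ G)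
    }

  joins⇒incident₁ : ∀ {e a b} → Joins T₀.graph e a b → Incident T₀.graph e a
  joins⇒incident₁ (inj₁ (p , _)) = inj₁ p
  joins⇒incident₁ (inj₂ (_ , q)) = inj₂ q

  joins⇒incident₂ : ∀ {e a b} → Joins T₀.graph e a b → Incident T₀.graph e b
  joins⇒incident₂ (inj₁ (_ , q)) = inj₂ q
  joins⇒incident₂ (inj₂ (p , _)) = inj₁ p

  adjacent-edges-SameComp : ∀ a e e' → Incident T₀.graph e a → Incident T₀.graph e' a →
                            T.SameComp (inj₂ (πE e)) (inj₂ (πE e'))
  adjacent-edges-SameComp a e e' e∋a e'∋a with T₀.SV a in a∈S?
  ... | true  = proj₁ (S₀-copies a a e e' a∈S? a∈S? refl e∋a e'∋a) refl
  ... | false = T.ev (πE e) (πV a) (πE-out e) πa∉S (Emb.map-Incident e∋a)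
              ◅ T.ve (πE e') (πV a) (πE-out e') πa∉S (Emb.map-Incident e'∋a) ◅ ε⋆
    where πa∉S = trans (sym (π-SV a)) a∈S?

  walk-vertex-SameComp : ∀ {a b n} (w : Walk T₀.graph T₀.len a b n) e₀ → Incident T₀.graph e₀ a →
                         ∀ {z} → z ∈ walkVerts T₀.graph w →
                         Σ (Fin T₀.nE) (λ d → Incident T₀.graph d z × T.SameComp (inj₂ (πE e₀)) (inj₂ (πE d)))
  walk-vertex-SameComp nil              e₀ e₀∋a (here refl) = e₀ , e₀∋a , ε⋆
  walk-vertex-SameComp (cons _ _ _)     e₀ e₀∋a (here refl) = e₀ , e₀∋a , ε⋆
  walk-vertex-SameComp {a} (cons e a~b w) e₀ e₀∋a (there z∈w) with walk-vertex-SameComp w e (joins⇒incident₂ a~b) z∈w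
  ... | d , d∋z , e~d = d , d∋z , (adjacent-edges-SameComp a e₀ e e₀∋a (joins⇒incident₁ a~b) ◅◅ e~d)

  πV-walkVerts-Unique : ∀ {a b n} (w : Walk T₀.graph T₀.len a b n) → Unique (walkVerts T₀.graph w) →
                        Unique (List.map πV (walkVerts T₀.graph w))
  πV-walkVerts-Unique nil              _            = [] ∷ []
  πV-walkVerts-Unique {a} (cons e a~b w) (a∉w ∷ unique) =
    Allₚ.map⁺ (All.tabulate (λ {z} z∈w → πa≢πz z z∈w)) ∷ πV-walkVerts-Unique w unique
    where
    πa≢πz : ∀ z → z ∈ walkVerts T₀.graph w → πV a ≢ πV z
    πa≢πz z z∈w πa≡πz with T₀.SV a in a∈S?
    ... | false = All.lookup a∉w z∈w (πV-inj-out a z a∈S? πa≡πz)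
    ... | true with walk-vertex-SameComp w e (joins⇒incident₂ a~b) z∈w
    ... | d , d∋z , e~d = All.lookup a∉w z∈w
      (proj₂ (S₀-copies a z e d a∈S? z∈S πa≡πz (joins⇒incident₁ a~b) d∋z) e~d)
      where z∈S = trans (π-SV z) (trans (cong T.SV (sym πa≡πz)) (trans (sym (π-SV a)) a∈S?))

  Special-pullback : ∀ u → Special T (πV u) → Special T₀ u
  Special-pullback u (inj₁ (deg≡1 , πu∈S , _)) with S₀-nonisolated u (trans (π-SV u) πu∈S)
  ... | d , d∋u = inj₁ ( ℕₚ.≤-antisym (subst (deg T₀.graph u ℕ.≤_) deg≡1 (Emb.deg-≤ πE-inj u)) (incident⇒1≤deg T₀.graph d∋u)
                       , trans (π-SV u) πu∈S
                       , λ d _ → trans (π-SE d) (πE-out d))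
  Special-pullback u (inj₂ (inj₁ (deg≡2 , πu∉S))) =
    inj₂ (inj₁ (trans (sym deg≡) deg≡2 , trans (π-SV u) πu∉S))
    where
    deg≡ = Emb.deg-≡ πE-inj u (λ a → πV-injective-outside u a (trans (π-SV u) πu∉S))
             (λ e e∋πu → πE-surj e (CT.incident-outside e (πV u) πu∉S e∋πu))
  Special-pullback u (inj₂ (inj₂ (_ , πu∈S , edges∈S))) with S₀-nonisolated u (trans (π-SV u) πu∈S)
  ... | d , d∋u = ⊥-elim (true≢false (trans (sym (edges∈S (πE d) (Emb.map-Incident d∋u))) (πE-out d)))
    where
    true≢false : true ≢ false
    true≢false ()

  ParityA-pullback : ParityA T → ParityA T₀
  ParityA-pullback = Emb.ParityA-pullback (λ P → Emb.map-Path P (πV-walkVerts-Unique (proj₁ P) (proj₂ P))) Special-pullback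

  ParityB-pullback : ParityB T → ParityB T₀
  ParityB-pullback = Emb.ParityB-pullback

module OfSingleOrbit (T T₀ : BYForest) (q' : ℕ) (O : SingleOrbit T T₀ q') where
  private
    module T  = BYForest T
    module T₀ = BYForest T₀
  open SingleOrbit O
  open Iterates T

  ιV-injective : Injective _≡_ _≡_ ιV
  ιV-injective {a} {b} ιa≡ιb = proj₂ (uniqV zero zero a b ιa≡ιb)

  ιE-injective : Injective _≡_ _≡_ ιE
  ιE-injective {a} {b} ιa≡ιb = proj₂ (uniqE zero zero a b ιa≡ιb)

  incident⇒image : ∀ w e → Incident T.graph e (ιV w) → Σ (Fin T₀.nE) (λ d → ιE d ≡ e)
  incident⇒image w e e∋ιw with coverE e
  ... | i , d , Fⁱιd≡e with iter-FE-Incident (toℕ i) (ιE d) (ιV w) (subst (λ z → Incident T.graph z (ιV w)) (sym Fⁱιd≡e) e∋ιw)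
  ... | x , ιd∋x , Fⁱx≡ιw with endpoint-in-image ιd∋x
    where
    endpoint-in-image : Incident T.graph (ιE d) x → Σ (Fin T₀.nV) (λ y → ιV y ≡ x)
    endpoint-in-image (inj₁ src≡x) = T₀.src d , trans (ι-src d) src≡x
    endpoint-in-image (inj₂ tgt≡x) = T₀.tgt d , trans (ι-tgt d) tgt≡x
  ... | y , refl = d , subst (λ i → iter T.FE (toℕ i) (ιE d) ≡ e) (proj₁ (uniqV i zero y w Fⁱx≡ιw)) Fⁱιd≡e

  module Emb = Embedding T₀ T ιV ιE ι-src ι-tgt ι-len ι-SV ι-SE ιE-injective (λ w a _ ιa≡ιw → ιV-injective ιa≡ιw)
    q' ι-FV ι-FE (λ d d∉S → trans (cong sgnℤ (ι-εE d d∉S)) (εⁿ≡Πˢ (suc q') (ιE d)))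

  open Decomposition T {suc q'} (λ _ → T₀) (λ i d → iter T.FE (toℕ i) (ιE d)) (λ i d → σ-signⁿ (toℕ i) (ιE d))

  Φ≅Ind : Φ T ≅ Ind q' (Φ T₀)
  Φ≅Ind = Iso.≅-Pieces (λ i d → σ-signⁿ*σ-signⁿ≡1 (toℕ i) (ιE d)) (λ i i' d d' p → proj₁ (uniqE i i' d d' p))
    (λ i {d} {d'} p → proj₂ (uniqE i i d d' p)) (λ e _ → coverE e) (λ i d → trans (ι-len d) (sym (len-iter-FE (toℕ i) (ιE d))))
    (λ i → Emb.extendⁿ-InΛ (toℕ i)) (λ i → Emb.restrictⁿ-InΛ (λ w e _ e∋ιw _ → incident⇒image w e e∋ιw) (toℕ i))
    (QMod.act (Ind q' (Φ T₀))) σ-shifts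
    where
    σ-shifts : ∀ {φ} → QMod.Good (Φ T) φ → ∀ i → QMod._~_ (Φ T₀) (toPieces (QMod.act (Φ T) φ) i) (QMod.act (Ind q' (Φ T₀)) (toPieces φ) i)
    σ-shifts {φ} G zero    = Chains.~-of-≡ T₀ (λ x x∈Λ → trans (Emb.Good-σ⁻¹-extend⁰ G x x∈Λ)
      (cong (λ m → φ (Emb.extendⁿ m (T₀.σ⁻¹ x))) (sym (toℕ-fromℕ q'))))
    σ-shifts {φ} G (suc i) = Chains.~-of-≡ T₀ (λ x x∈Λ → trans (Emb.Good-σ⁻¹-extendⁿ-suc G (toℕ i) x x∈Λ)
      (cong (λ m → φ (Emb.extendⁿ m x)) (sym (toℕ-inject₁ i))))

  ParityA-pullback : ParityA T → ParityA T₀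
  ParityA-pullback = Emb.ParityA-pullback (Emb.map-Path-injective ιV-injective) (Emb.Special-pullback ιV-injective incident⇒image)

  ParityB-pullback : ParityB T → ParityB T₀
  ParityB-pullback = Emb.ParityB-pullback

-- Forests carry no nonzero cycles

module NonBacktrackingWalk (G : Graph) (V : ℕ → Fin (Graph.nV G)) (E : ℕ → Fin (Graph.nE G))
  (step : ∀ n → Joins G (E n) (V n) (V (suc n)))
  (non-backtracking : ∀ n → E (suc n) ≢ E n)
  where
  open Graph G

  -- Between the first repeated vertex V i₀ = V j₁ the walk is a cycle; non-backtracking makes
  -- its edges distinct.
  Repeats : ℕ → Set
  Repeats j = Σ ℕ (λ i → i ℕ.< j × V i ≡ V j)

  repeats? : ∀ j → Dec (Repeats j)
  repeats? j with any? {n = j} (λ t → V (toℕ t) ≟ V j)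
  ... | yes (t , Vt≡Vj) = yes (toℕ t , toℕ<n t , Vt≡Vj)
  ... | no ∄t = no (λ { (i , i<j , Vi≡Vj) → ∄t (fromℕ< i<j , trans (cong V (toℕ-fromℕ< i<j)) Vi≡Vj) })

  firstRepeat : Σ ℕ (λ j₁ → Repeats j₁ × (∀ j → j ℕ.< j₁ → ¬ Repeats j))
  firstRepeat with ¬∀⟶∃¬-smallest (suc nV) (λ t → ¬ Repeats (toℕ t)) (λ t → ¬? (repeats? (toℕ t))) some-repeat
    where
    some-repeat : ¬ (∀ t → ¬ Repeats (toℕ t))
    some-repeat none with pigeonhole (ℕₚ.n<1+n nV) (λ t → V (toℕ t))
    ... | a , b , a<b , Va≡Vb = none b (toℕ a , a<b , Va≡Vb)
  ... | t , ¬¬repeats , earlier = toℕ t , decidable-stable (repeats? (toℕ t)) ¬¬repeats ,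
    λ j j<t → subst (λ m → ¬ Repeats m) (trans (toℕ-inject (fromℕ< j<t)) (toℕ-fromℕ< j<t)) (earlier (fromℕ< j<t))

  j₁ : ℕ
  j₁ = proj₁ firstRepeat

  i₀ : ℕ
  i₀ = proj₁ (proj₁ (proj₂ firstRepeat))

  i₀<j₁ : i₀ ℕ.< j₁
  i₀<j₁ = proj₁ (proj₂ (proj₁ (proj₂ firstRepeat)))

  Vi₀≡Vj₁ : V i₀ ≡ V j₁
  Vi₀≡Vj₁ = proj₂ (proj₂ (proj₁ (proj₂ firstRepeat)))

  V-injective-below-j₁ : ∀ a b → a ℕ.< j₁ → b ℕ.< j₁ → V a ≡ V b → a ≡ b
  V-injective-below-j₁ a b a<j₁ b<j₁ Va≡Vb with ℕₚ.<-cmp a b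
  ... | tri< a<b _ _ = ⊥-elim (proj₂ (proj₂ firstRepeat) b b<j₁ (a , a<b , Va≡Vb))
  ... | tri≈ _ a≡b _ = a≡b
  ... | tri> _ _ b<a = ⊥-elim (proj₂ (proj₂ firstRepeat) a a<j₁ (b , b<a , sym Va≡Vb))

  len : ℕ
  len = proj₁ (ℕₚ.m≤n⇒∃[o]m+o≡n i₀<j₁)

  j₁≡ : suc (i₀ ℕ.+ len) ≡ j₁
  j₁≡ = proj₂ (ℕₚ.m≤n⇒∃[o]m+o≡n i₀<j₁)

  i₀+a<j₁ : ∀ a → a ℕ.≤ len → i₀ ℕ.+ a ℕ.< j₁
  i₀+a<j₁ a a≤len = subst (i₀ ℕ.+ a ℕ.<_) j₁≡ (ℕ.s≤s (ℕₚ.+-monoʳ-≤ i₀ a≤len))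

  toℕ≤len : (t : Fin (suc len)) → toℕ t ℕ.≤ len
  toℕ≤len t = ℕₚ.≤-pred (toℕ<n t)

  same-edge-ends : ∀ {e p q p' q'} → Joins G e p q → Joins G e p' q' → (p ≡ p') ⊎ (p ≡ q' × q ≡ p')
  same-edge-ends (inj₁ (a , b)) (inj₁ (c , d)) = inj₁ (trans (sym a) c)
  same-edge-ends (inj₁ (a , b)) (inj₂ (c , d)) = inj₂ (trans (sym a) c , trans (sym b) d)
  same-edge-ends (inj₂ (a , b)) (inj₁ (c , d)) = inj₂ (trans (sym b) d , trans (sym a) c)
  same-edge-ends (inj₂ (a , b)) (inj₂ (c , d)) = inj₁ (trans (sym b) d)

  E-injective-on-cycle : ∀ a b → a ℕ.≤ len → b ℕ.≤ len → E (i₀ ℕ.+ a) ≡ E (i₀ ℕ.+ b) → a ≡ b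
  E-injective-on-cycle a b a≤ b≤ Ea≡Eb
    with same-edge-ends (step (i₀ ℕ.+ a)) (subst (λ z → Joins G z (V (i₀ ℕ.+ b)) (V (suc (i₀ ℕ.+ b)))) (sym Ea≡Eb) (step (i₀ ℕ.+ b)))
  ... | inj₁ Va≡Vb = ℕₚ.+-cancelˡ-≡ i₀ a b (V-injective-below-j₁ _ _ (i₀+a<j₁ a a≤) (i₀+a<j₁ b b≤) Va≡Vb)
  ... | inj₂ (Va≡Vb+1 , Va+1≡Vb) with ℕₚ.<-cmp a b
  ...   | tri≈ _ a≡b _ = a≡b
  ...   | tri< a<b _ _ = ⊥-elim (non-backtracking (i₀ ℕ.+ a) (trans (cong E a+1≡b) (sym Ea≡Eb)))
    where
    a+1≡b : suc (i₀ ℕ.+ a) ≡ i₀ ℕ.+ b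
    a+1≡b = V-injective-below-j₁ _ _ (subst (ℕ._< j₁) (ℕₚ.+-suc i₀ a) (i₀+a<j₁ (suc a) (ℕₚ.≤-trans a<b b≤))) (i₀+a<j₁ b b≤) Va+1≡Vb
  ...   | tri> _ _ b<a = ⊥-elim (non-backtracking (i₀ ℕ.+ b) (trans (cong E (sym a≡b+1)) Ea≡Eb))
    where
    a≡b+1 : i₀ ℕ.+ a ≡ suc (i₀ ℕ.+ b)
    a≡b+1 = V-injective-below-j₁ _ _ (i₀+a<j₁ a a≤) (subst (ℕ._< j₁) (ℕₚ.+-suc i₀ b) (i₀+a<j₁ (suc b) (ℕₚ.≤-trans b<a a≤))) Va≡Vb+1

  cycle : Cycle G
  cycle = record
    { k = len
    ; vs = λ t → V (i₀ ℕ.+ toℕ t)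
    ; es = λ t → E (i₀ ℕ.+ toℕ t)
    ; closed = trans (cong V (ℕₚ.+-identityʳ i₀))
        (trans Vi₀≡Vj₁ (cong V (sym (trans (cong (i₀ ℕ.+_) (toℕ-fromℕ (suc len))) (trans (ℕₚ.+-suc i₀ len) j₁≡)))))
    ; vs-inj = λ {a} {b} p → inject₁-injective (toℕ-injective
        (ℕₚ.+-cancelˡ-≡ i₀ _ _ (V-injective-below-j₁ _ _
           (i₀+a<j₁ _ (subst (ℕ._≤ len) (sym (toℕ-inject₁ a)) (toℕ≤len a)))
           (i₀+a<j₁ _ (subst (ℕ._≤ len) (sym (toℕ-inject₁ b)) (toℕ≤len b))) p)))
    ; es-inj = λ {a} {b} p → toℕ-injective (E-injective-on-cycle (toℕ a) (toℕ b) (toℕ≤len a) (toℕ≤len b) p)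
    ; joins = λ t → subst₂ (Joins G (E (i₀ ℕ.+ toℕ t)))
        (cong (λ z → V (i₀ ℕ.+ z)) (sym (toℕ-inject₁ t)))
        (cong V (sym (ℕₚ.+-suc i₀ (toℕ t))))
        (step (i₀ ℕ.+ toℕ t))
    }

module ClosedChain (T : BYForest) (x : BYForest.Chain T) (∂x≡0 : ∀ v → BYForest.∂ T x v ≡ 0ℤ) where
  open BYForest T
  open Chains T

  inc*inc≡1 : ∀ e u → Incident graph e u → inc e u * inc e u ≡ 1ℤ
  inc*inc≡1 e u (inj₁ src≡u) with tgt e ≟ u | src e ≟ u
  ... | yes tgt≡u | _          = ⊥-elim (src≢tgt e (trans src≡u (sym tgt≡u)))
  ... | no _      | yes _      = refl
  ... | no _      | no src≢u  = ⊥-elim (src≢u src≡u)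
  inc*inc≡1 e u (inj₂ tgt≡u) with tgt e ≟ u | src e ≟ u
  ... | yes _     | yes src≡u = ⊥-elim (src≢tgt e (trans src≡u (sym tgt≡u)))
  ... | yes _     | no _      = refl
  ... | no tgt≢u  | _         = ⊥-elim (tgt≢u tgt≡u)

  -- ∂ x u = 0 while the coefficient ±1 of e at u is a unit, so e cannot be alone at u
  another-edge : ∀ u e → Incident graph e u → x e ≢ 0ℤ →
                 Σ (Fin nE) (λ e' → e' ≢ e × x e' ≢ 0ℤ × Incident graph e' u)
  another-edge u e e∋u xe≢0 with any? (λ d → ¬? (d ≟ e) ×-dec ¬? (x d ℤ.≟ 0ℤ) ×-dec ((src d ≟ u) ⊎-dec (tgt d ≟ u)))
  ... | yes found = found
  ... | no ∄e' = ⊥-elim (xe≢0 (unit*z≡0⇒z≡0 (inc e u) (x e) (inc*inc≡1 e u e∋u)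
                   (trans (sym (Σℤ-single e others-vanish)) (∂x≡0 u))))
    where
    others-vanish : ∀ d → d ≢ e → inc d u * x d ≡ 0ℤ
    others-vanish d d≢e with x d ℤ.≟ 0ℤ
    ... | yes xd≡0 = trans (cong (inc d u *_) xd≡0) (*-zeroʳ (inc d u))
    ... | no xd≢0 with incident-or-inc≡0 d u
    ...   | inj₁ d∋u    = ⊥-elim (∄e' (d , d≢e , xd≢0 , d∋u))
    ...   | inj₂ inc≡0 = cong (_* x d) inc≡0

  other-end : Fin nE → Fin nV → Fin nV
  other-end e u with src e ≟ u
  ... | yes _ = tgt e
  ... | no _  = src e

  joins-other-end : ∀ e u → Incident graph e u → Joins graph e u (other-end e u) × Incident graph e (other-end e u)
  joins-other-end e u e∋u with src e ≟ u
  ... | yes src≡u = inj₁ (src≡u , refl) , inj₂ refl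
  joins-other-end e u (inj₁ src≡u) | no src≢u = ⊥-elim (src≢u src≡u)
  joins-other-end e u (inj₂ tgt≡u) | no _     = inj₂ (refl , tgt≡u) , inj₁ refl

  record Arrival : Set where
    constructor arrive
    field
      at      : Fin nV
      via     : Fin nE
      via∋at  : Incident graph via at
      x-via≢0 : x via ≢ 0ℤ

  continue : Arrival → Arrival
  continue (arrive u e e∋u xe≢0) with another-edge u e e∋u xe≢0
  ... | e' , _ , xe'≢0 , e'∋u = arrive (other-end e' u) e' (proj₂ (joins-other-end e' u e'∋u)) xe'≢0

  continue-step : ∀ a → Joins graph (Arrival.via (continue a)) (Arrival.at a) (Arrival.at (continue a))
                      × Arrival.via (continue a) ≢ Arrival.via a
  continue-step (arrive u e e∋u xe≢0) with another-edge u e e∋u xe≢0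
  ... | e' , e'≢e , _ , e'∋u = proj₁ (joins-other-end e' u e'∋u) , e'≢e

  closed-chain-vanishes : ∀ e → x e ≡ 0ℤ
  closed-chain-vanishes e₀ with x e₀ ℤ.≟ 0ℤ
  ... | yes xe₀≡0 = xe₀≡0
  ... | no xe₀≢0 = ⊥-elim (forest (NonBacktrackingWalk.cycle graph V E step non-backtracking))
    where
    walk : ℕ → Arrival
    walk n = iter continue n (arrive (tgt e₀) e₀ (inj₂ refl) xe₀≢0)
    V : ℕ → Fin nV
    V zero    = src e₀
    V (suc n) = Arrival.at (walk n)
    E : ℕ → Fin nE
    E n = Arrival.via (walk n)
    step : ∀ n → Joins graph (E n) (V n) (V (suc n))
    step zero    = inj₁ (refl , refl)
    step (suc n) = proj₁ (continue-step (walk n))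
    non-backtracking : ∀ n → E (suc n) ≢ E n
    non-backtracking n = proj₂ (continue-step (walk n))

Φ-EmptyS-IsZero : ∀ T → EmptyS T → IsZero (Φ T)
Φ-EmptyS-IsZero T (V∉S , _) G = ~-of-≡ (λ x x∈Λ →
  Good-zero G x x∈Λ (ClosedChain.closed-chain-vanishes T x (λ v → proj₂ x∈Λ v (V∉S v))))
  where open Chains T

Φ-FullS-IsZero : ∀ T → FullS T → IsZero (Φ T)
Φ-FullS-IsZero T (_ , E∈S) G = ~-of-≡ (λ x x∈Λ → Good-zero G x x∈Λ (λ e → proj₁ x∈Λ e (E∈S e)))
  where open Chains T

lemma3p1 :
    -- (1) splitting T into the closures of the components of T ∖ S
    (∀ (T T₀ : BYForest) → ClosureSplitting T₀ T →
        (Φ T ≅ Φ T₀) × (ParityA T → ParityA T₀) × (ParityB T → ParityB T₀))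
    -- (2) disjoint unions of F-stable BY subforests
    × (∀ (T : BYForest) (k : ℕ) (Ts : Fin k → BYForest) → DisjointUnion T Ts →
        (Φ T ≅ ⨁ (λ i → Φ (Ts i)))
        × (ParityA T → ∀ i → ParityA (Ts i))
        × (ParityB T → ∀ i → ParityB (Ts i)))
    -- (3) a single F-orbit of q = suc q' trees
    × (∀ (T T₀ : BYForest) (q' : ℕ) → SingleOrbit T T₀ q' →
        (Φ T ≅ Ind q' (Φ T₀)) × (ParityA T → ParityA T₀) × (ParityB T → ParityB T₀))
    -- (4) S = ∅ or S = T
    × (∀ (T : BYForest) → EmptyS T ⊎ FullS T → IsZero (Φ T))
lemma3p1 =
    (λ T T₀ C → let open OfClosureSplitting T T₀ C in Φ≅Φ₀ , ParityA-pullback , ParityB-pullback)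
  , (λ T k Ts D → let open OfDisjointUnion T k Ts D in Φ≅⨁ , ParityA-pullback , ParityB-pullback)
  , (λ T T₀ q' O → let open OfSingleOrbit T T₀ q' O in Φ≅Ind , ParityA-pullback , ParityB-pullback)
  , λ { T (inj₁ S≡∅) → Φ-EmptyS-IsZero T S≡∅ ; T (inj₂ S≡T) → Φ-FullS-IsZero T S≡T }
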